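{- Let $k$ be a positive integer. (a) For the Petersen graph $\mathcal{P}$, $\dim_{k,f}(\mathcal{P})=\frac{5}{3}$. (b) For $n\ge 3$, $\dim_{k,f}(C_n+K_1)=2$ if $n\in\{3,4\}$, $=\frac32$ if $n=5$, and $=\frac{n}{4}$ if $n\ge 6$. (c) For $m\ge 2$, let $G=K_{a_1,a_2,\ldots,a_m}$ be a complete $m$-partite graph of order $n=\sum_{i=1}^m a_i$, and let $s$ be the number of partite sets of $G$ consisting of exactly one vertex. Then $\dim_{k,f}(G)=\frac{n-1}{2}$ if $s=1$, and $\dim_{k,f}(G)=\frac n2$ otherwise.
   Context: All graphs are finite, simple, undirected and connected. $C_n$ is the cycle on $n$ vertices, $K_1$ a single vertex, and $G+H$ is the join (disjoint union plus all edges between $G$ and $H$). $d(x,y)$ denotes the distance. For a positive integer $k$, $d_k(x,y)=\min\{d(x,y),k+1\}$, and for distinct $x,y\in V(G)$, $R_k\{x,y\}=\{z\in V(G): d_k(x,z)\neq d_k(y,z)\}$. For $g$ defined on $V(G)$ and $U\subseteq V(G)$, $g(U)=\sum_{s\in U}g(s)$. A function $h:V(G)\to[0,1]$ is a $k$-truncated resolving function of $G$ if $h(R_k\{x,y\})\ge 1$ for all distinct $x,y\in V(G)$; $\dim_{k,f}(G)=\min\{h(V(G)): h \text{ is a } k\text{ -truncated resolving function of } G\}$.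
   Formalization: The k-truncated resolving functions take rational values in ℚ ∩ [0,1] rather than real values in $[0,1]$. -}

module Defs where

open import Data.Nat using (ℕ; zero; suc; _+_; _∸_; _⊓_; _≡ᵇ_; _%_; _<ᵇ_)
open import Data.Bool using (Bool; true; false; _∧_; _∨_; not; if_then_else_)
open import Data.Fin using (Fin; toℕ; _≟_)
open import Data.List using (List; foldr; allFin)
open import Data.Bool.ListAction using (any)
open import Data.Product using (_×_; Σ; ∃)
open import Relation.Nullary.Decidable using (isYes)
open import Relation.Binary.PropositionalEquality using (_≡_; _≢_)
open import Data.Integer using (+_)
open import Data.Rational using (ℚ; 0ℚ; 1ℚ; _≤_) renaming (_+_ to _+ℚ_)

Graph : ℕ → Set
Graph n = Fin n → Fin n → Bool

module _ {n : ℕ} (G : Graph n) where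

  reach : ℕ → Fin n → Fin n → Bool
  reach zero    x y = isYes (x ≟ y)
  reach (suc l) x y = reach l x y ∨ any (λ z → G x z ∧ reach l z y) (allFin n)

  search : ℕ → ℕ → Fin n → Fin n → ℕ
  search zero    l x y = l
  search (suc f) l x y = if reach l x y then l else search f (suc l) x y

  -- graph distance d(x,y) (correct for connected graphs, where d(x,y) < n)
  dist : Fin n → Fin n → ℕ
  dist x y = search n 0 x y

  distk : ℕ → Fin n → Fin n → ℕ
  distk k x y = dist x y ⊓ suc k

  inR : ℕ → Fin n → Fin n → Fin n → Bool
  inR k x y z = not (distk k x z ≡ᵇ distk k y z)

weight : {n : ℕ} → (Fin n → ℚ) → (Fin n → Bool) → ℚ
weight {n} h P = foldr (λ z acc → (if P z then h z else 0ℚ) +ℚ acc) 0ℚ (allFin n)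

IsResolvingFn : {n : ℕ} → Graph n → ℕ → (Fin n → ℚ) → Set
IsResolvingFn {n} G k h =
  ((v : Fin n) → (0ℚ ≤ h v) × (h v ≤ 1ℚ)) ×
  ((x y : Fin n) → x ≢ y → 1ℚ ≤ weight h (inR G k x y))

DimKF : {n : ℕ} → Graph n → ℕ → ℚ → Set
DimKF {n} G k r =
  (Σ (Fin n → ℚ) λ h → IsResolvingFn G k h × weight h (λ _ → true) ≡ r) ×
  ((h : Fin n → ℚ) → IsResolvingFn G k h → r ≤ weight h (λ _ → true))

-- Petersen graph on Fin 10: outer 5-cycle 0..4, inner pentagram 5..9, spokes i ~ i+5
petersen : Graph 10
petersen x y = outer ∨ inner ∨ spoke
  where
    a = toℕ x
    b = toℕ y
    lt5 : ℕ → Bool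
    lt5 m = m <ᵇ 5
    outer = lt5 a ∧ lt5 b ∧ (((a + 1) % 5 ≡ᵇ b) ∨ ((b + 1) % 5 ≡ᵇ a))
    inner = not (lt5 a) ∧ not (lt5 b) ∧
            ((((a ∸ 5) + 2) % 5 ≡ᵇ (b ∸ 5)) ∨ (((b ∸ 5) + 2) % 5 ≡ᵇ (a ∸ 5)))
    spoke = (b ≡ᵇ a + 5) ∨ (a ≡ᵇ b + 5)

cycleAdj : (n : ℕ) → Graph n
cycleAdj n x y = succ a b ∨ succ b a
  where
    a = toℕ x
    b = toℕ y
    succ : ℕ → ℕ → Bool
    succ i j = (j ≡ᵇ suc i) ∨ ((i ≡ᵇ n ∸ 1) ∧ (j ≡ᵇ 0))

-- the wheel C_n + K_1 on Fin (suc n): vertex zero is the K_1, vertex suc i is cycle vertex i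
wheel : (n : ℕ) → Graph (suc n)
wheel n Fin.zero    Fin.zero    = false
wheel n Fin.zero    (Fin.suc j) = true
wheel n (Fin.suc i) Fin.zero    = true
wheel n (Fin.suc i) (Fin.suc j) = cycleAdj n i j

multipartite : {n m : ℕ} → (Fin n → Fin m) → Graph n
multipartite c x y = not (isYes (c x ≟ c y))

count : {n : ℕ} → (Fin n → Bool) → ℕ
count {n} P = foldr (λ z acc → if P z then suc acc else acc) 0 (allFin n)

partSize : {n m : ℕ} → (Fin n → Fin m) → Fin m → ℕ
partSize c i = count (λ x → isYes (c x ≟ i))

singletonParts : {n m : ℕ} → (Fin n → Fin m) → ℕ
singletonParts {m = m} c = count (λ i → partSize c i ≡ᵇ 1)

module Submission where

-- All three families have diameter 2, so for k ≥ 1 every truncated distance is the distance 0, 1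
-- or 2, and R_k{x,y} consists of x, y and the vertices adjacent to exactly one of them. Each value is
-- attained by an explicit resolving function (¼ on the rim of a large wheel, ½ on every vertex of a
-- complete multipartite graph that has a twin) and matched by a dual lower bound: for the Petersen
-- graph and C_n + K_1 with n ≤ 5, a weighting of pairs whose sets R{x,y} cover every vertex at most
-- once; for n ≥ 6, the sets R{v_{j+1}, v_{j+2}}, each inside the window v_j, …, v_{j+3}, where the
-- windows cover every rim vertex four times; for complete multipartite graphs, the twin pairs (same
-- part, or two singleton parts), for which R{x,y} = {x, y}. A vertex has no twin exactly when it is
-- the only singleton part, which accounts for (n - 1)/2.

open import Defs
open import Algebra.Bundles using (Ring)
import Algebra.Properties.Semiring.Sum as Sum
open import Data.Bool using (Bool; true; false; T; not; _∧_; _∨_; if_then_else_)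
open import Data.Bool.ListAction using (any)
open import Data.Bool.Properties using (T-∧; T-∨; T-≡; T?; ∧-identityʳ)
open import Data.Empty using (⊥)
open import Data.Fin using (Fin; zero; suc; _≟_; #_; toℕ; fromℕ; inject₁; lower₁; punchIn)
import Data.Fin.Properties as Fin
open import Data.Integer using (+_)
import Data.Integer.Solver as ℤ
open import Data.List using (List; []; _∷_; tabulate; map; foldr; allFin)
open import Data.List.Membership.Propositional using (_∈_; lose)
open import Data.List.Membership.Propositional.Properties using (∈-allFin)
open import Data.List.Properties using (foldr-map; map-tabulate)
open import Data.List.Relation.Unary.All as All using (All; []; _∷_)
open import Data.List.Relation.Unary.AllPairs using ([]; _∷_)
open import Data.List.Relation.Unary.Any using (satisfied; here; there)
open import Data.List.Relation.Unary.Any.Properties using (any⁺; any⁻)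
open import Data.List.Relation.Unary.Unique.Propositional using (Unique)
open import Data.Nat as ℕ using (ℕ; _≤_; _∸_)
open import Data.Nat.DivMod using (_mod_; m≡m%n+[m/n]*n; %-distribˡ-+; m%n%n≡m%n; m<n⇒m%n≡m; n%n≡0)
import Data.Nat.Properties as ℕ
open import Data.Nat.Properties using (≡ᵇ⇒≡; ≡⇒≡ᵇ)
open import Data.Product using (_×_; _,_; ∃-syntax; proj₁; proj₂)
open import Data.Rational as ℚ using (ℚ; 0ℚ; 1ℚ; _+_; _*_; _/_; toℚᵘ)
import Data.Rational.Properties as ℚ
import Data.Rational.Solver as ℚ
open import Data.Rational.Unnormalised as ℚᵘ using (mkℚᵘ; *≡*)
import Data.Rational.Unnormalised.Properties as ℚᵘ
open import Data.Sum using (_⊎_; inj₁; inj₂)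
import Data.Sum
open import Function using (_∘_; id; flip; Surjective)
open import Function.Bundles using (_⇔_; mk⇔; module Equivalence)
open import Relation.Binary.PropositionalEquality
open import Relation.Nullary.Decidable
  using (Dec; isYes; yes; no; True; toWitness; fromWitness; toWitnessFalse; fromWitnessFalse; decidable-stable;
         ¬?; _×-dec_; _→-dec_; _⊎-dec_)
open import Relation.Nullary.Negation using (¬_; contradiction)

open Sum (Ring.semiring ℚ.+-*-ring)
  using (sum; sum-syntax; ∑-distrib-+; ∑-comm; *-distribˡ-sum; *-distribʳ-sum; sum-cong-≗; sum-replicate-zero;
         sum-init-last)

T-injective : ∀ {a b} → (T a → T b) → (T b → T a) → a ≡ b
T-injective {false} {false} _ _ = refl
T-injective {false} {true}  _ g = contradiction (g _) id
T-injective {true}  {false} f _ = contradiction (f _) id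
T-injective {true}  {true}  _ _ = refl

T-not⇒¬T : ∀ {b} → T (not b) → ¬ T b
T-not⇒¬T {false} _ ()

T-≡ᵇ : ∀ {a b} → T (a ℕ.≡ᵇ b) ⇔ a ≡ b
T-≡ᵇ {a} {b} = mk⇔ (≡ᵇ⇒≡ a b) (≡⇒≡ᵇ a b)

≡ᵇ-comm : ∀ m n → (m ℕ.≡ᵇ n) ≡ (n ℕ.≡ᵇ m)
≡ᵇ-comm ℕ.zero    ℕ.zero    = refl
≡ᵇ-comm ℕ.zero    (ℕ.suc n) = refl
≡ᵇ-comm (ℕ.suc m) ℕ.zero    = refl
≡ᵇ-comm (ℕ.suc m) (ℕ.suc n) = ≡ᵇ-comm m n

1≢2 : 1 ≢ 2
1≢2 ()

isYes-suc≟suc : ∀ {n} (x y : Fin n) → isYes (suc x ≟ suc y) ≡ isYes (x ≟ y)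
isYes-suc≟suc x y with x ≟ y
... | yes _ = refl
... | no  _ = refl

any-allFin : ∀ {n} (p : Fin n → Bool) → T (any p (allFin n)) ⇔ (∃[ w ] T (p w))
any-allFin {n} p =
  mk⇔ (satisfied ∘ any⁻ p (allFin n)) (λ (w , pw) → any⁺ {xs = allFin n} p (lose (∈-allFin w) pw))

≤-decide : ∀ {p q} → True (p ℚ.≤? q) → p ℚ.≤ q
≤-decide = toWitness

+-cancelʳ-≤ : ∀ r p q → p + r ℚ.≤ q + r → p ℚ.≤ q
+-cancelʳ-≤ r p q p+r≤q+r = begin
  p              ≡⟨ cancel p ⟨
  p + r ℚ.- r    ≤⟨ ℚ.+-monoˡ-≤ (ℚ.- r) p+r≤q+r ⟩
  q + r ℚ.- r    ≡⟨ cancel q ⟩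
  q              ∎
  where
  open ℚ.≤-Reasoning
  cancel : ∀ x → x + r ℚ.- r ≡ x
  cancel x = trans (ℚ.+-assoc x r (ℚ.- r)) (trans (cong (x ℚ.+_) (ℚ.+-inverseʳ r)) (ℚ.+-identityʳ x))

+-cancelʳ-≡ : ∀ r p q → p + r ≡ q + r → p ≡ q
+-cancelʳ-≡ r p q eq =
  ℚ.≤-antisym (+-cancelʳ-≤ r p q (ℚ.≤-reflexive eq)) (+-cancelʳ-≤ r q p (ℚ.≤-reflexive (sym eq)))

+-/ : ∀ a b d → + (a ℕ.+ b) / ℕ.suc d ≡ + a / ℕ.suc d + + b / ℕ.suc d
+-/ a b d = ℚ.toℚᵘ-injective (begin
  toℚᵘ (+ (a ℕ.+ b) / ℕ.suc d)
    ≈⟨ ℚ.toℚᵘ-fromℚᵘ (mkℚᵘ (+ (a ℕ.+ b)) d) ⟩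
  mkℚᵘ (+ (a ℕ.+ b)) d
    ≈⟨ *≡* (solve 3 (λ a b d → (a :+ b) :* (d :* d) := (a :* d :+ b :* d) :* d) refl (+ a) (+ b) (+ ℕ.suc d)) ⟩
  mkℚᵘ (+ a) d ℚᵘ.+ mkℚᵘ (+ b) d
    ≈⟨ ℚᵘ.+-cong (ℚᵘ.≃-sym (ℚ.toℚᵘ-fromℚᵘ (mkℚᵘ (+ a) d)))
                 (ℚᵘ.≃-sym (ℚ.toℚᵘ-fromℚᵘ (mkℚᵘ (+ b) d))) ⟩
  toℚᵘ (+ a / ℕ.suc d) ℚᵘ.+ toℚᵘ (+ b / ℕ.suc d)
    ≈⟨ ℚ.toℚᵘ-homo-+ (+ a / ℕ.suc d) (+ b / ℕ.suc d) ⟨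
  toℚᵘ (+ a / ℕ.suc d + + b / ℕ.suc d) ∎)
  where
  open ℚᵘ.≃-Reasoning
  open ℤ.+-*-Solver

restrict : {n : ℕ} → (Fin n → Bool) → (Fin n → ℚ) → Fin n → ℚ
restrict P h z = if P z then h z else 0ℚ

restrict-yes : ∀ {n} (P : Fin n → Bool) h z → T (P z) → restrict P h z ≡ h z
restrict-yes P h z Pz with P z
... | true = refl

restrict-no : ∀ {n} (P : Fin n → Bool) h z → ¬ T (P z) → restrict P h z ≡ 0ℚ
restrict-no P h z ¬Pz with P z
... | true  = contradiction _ ¬Pz
... | false = refl

restrict-zero : ∀ {n} (P : Fin n → Bool) z → restrict P (λ _ → 0ℚ) z ≡ 0ℚ
restrict-zero P z with P z
... | true  = refl
... | false = refl

weight-suc : ∀ {n} (h : Fin (ℕ.suc n) → ℚ) P →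
             weight h P ≡ restrict P h zero + weight (h ∘ suc) (P ∘ suc)
weight-suc {n} h P = cong (restrict P h zero ℚ.+_) (begin
  foldr c 0ℚ (tabulate suc)          ≡⟨ cong (foldr c 0ℚ) (map-tabulate id suc) ⟨
  foldr c 0ℚ (map suc (tabulate id)) ≡⟨ foldr-map c suc 0ℚ (tabulate id) ⟩
  weight (h ∘ suc) (P ∘ suc)         ∎)
  where
  open ≡-Reasoning
  c : Fin (ℕ.suc n) → ℚ → ℚ
  c z acc = restrict P h z + acc

weight≡∑ : ∀ {n} (h : Fin n → ℚ) P → weight h P ≡ ∑[ z < n ] restrict P h z
weight≡∑ {ℕ.zero}  h P = refl
weight≡∑ {ℕ.suc n} h P =
  trans (weight-suc h P) (cong (restrict P h zero ℚ.+_) (weight≡∑ (h ∘ suc) (P ∘ suc)))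

weight-cong : ∀ {n} (h : Fin n → ℚ) {P Q : Fin n → Bool} → (∀ z → P z ≡ Q z) →
              weight h P ≡ weight h Q
weight-cong h {P} {Q} P≗Q = trans (weight≡∑ h P)
  (trans (sum-cong-≗ (λ z → cong (λ b → if b then h z else 0ℚ) (P≗Q z))) (sym (weight≡∑ h Q)))

∑-mono-≤ : ∀ {n} {f g : Fin n → ℚ} → (∀ i → f i ℚ.≤ g i) → ∑[ i < n ] f i ℚ.≤ ∑[ i < n ] g i
∑-mono-≤ {ℕ.zero}  f≤g = ℚ.≤-refl
∑-mono-≤ {ℕ.suc n} f≤g = ℚ.+-mono-≤ (f≤g zero) (∑-mono-≤ (f≤g ∘ suc))

weight-complement : ∀ {n} (h : Fin n → ℚ) P → weight h P + weight h (not ∘ P) ≡ ∑[ z < n ] h z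
weight-complement {n} h P = begin
  weight h P + weight h (not ∘ P)
    ≡⟨ cong₂ _+_ (weight≡∑ h P) (weight≡∑ h (not ∘ P)) ⟩
  ∑[ z < n ] restrict P h z + ∑[ z < n ] restrict (not ∘ P) h z
    ≡⟨ ∑-distrib-+ (restrict P h) (restrict (not ∘ P) h) ⟨
  ∑[ z < n ] (restrict P h z + restrict (not ∘ P) h z)
    ≡⟨ sum-cong-≗ split ⟩
  ∑[ z < n ] h z ∎
  where
  open ≡-Reasoning
  split : ∀ z → restrict P h z + restrict (not ∘ P) h z ≡ h z
  split z with P z
  ... | true  = ℚ.+-identityʳ (h z)
  ... | false = ℚ.+-identityˡ (h z)

∑ₗ : {A : Set} → (A → ℚ) → List A → ℚ
∑ₗ f []       = 0ℚ
∑ₗ f (a ∷ as) = f a + ∑ₗ f as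

∑ₗ-cong : ∀ {A : Set} {f g : A → ℚ} (as : List A) → (∀ a → f a ≡ g a) → ∑ₗ f as ≡ ∑ₗ g as
∑ₗ-cong []       f≗g = refl
∑ₗ-cong (a ∷ as) f≗g = cong₂ _+_ (f≗g a) (∑ₗ-cong as f≗g)

∑ₗ-nonneg : ∀ {A : Set} {f : A → ℚ} (as : List A) → (∀ a → 0ℚ ℚ.≤ f a) → 0ℚ ℚ.≤ ∑ₗ f as
∑ₗ-nonneg []       f≥0 = ℚ.≤-refl
∑ₗ-nonneg (a ∷ as) f≥0 = ℚ.+-mono-≤ (f≥0 a) (∑ₗ-nonneg as f≥0)

∑ₗ-*ʳ : ∀ {A : Set} (f : A → ℚ) t (as : List A) → ∑ₗ (λ a → f a * t) as ≡ ∑ₗ f as * t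
∑ₗ-*ʳ f t []       = sym (ℚ.*-zeroˡ t)
∑ₗ-*ʳ f t (a ∷ as) =
  trans (cong (f a * t ℚ.+_) (∑ₗ-*ʳ f t as)) (sym (ℚ.*-distribʳ-+ t (f a) (∑ₗ f as)))

∑ₗ-mono-≤ : ∀ {A : Set} {f g : A → ℚ} {as : List A} → All (λ a → f a ℚ.≤ g a) as →
            ∑ₗ f as ℚ.≤ ∑ₗ g as
∑ₗ-mono-≤ []             = ℚ.≤-refl
∑ₗ-mono-≤ (fa≤ga ∷ f≤g) = ℚ.+-mono-≤ fa≤ga (∑ₗ-mono-≤ f≤g)

∑ₗ-∑-comm : ∀ {A : Set} {n} (f : A → Fin n → ℚ) (as : List A) →
            ∑ₗ (λ a → ∑[ z < n ] f a z) as ≡ ∑[ z < n ] ∑ₗ (λ a → f a z) as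
∑ₗ-∑-comm {n = n} f []       = sym (sum-replicate-zero n)
∑ₗ-∑-comm         f (a ∷ as) =
  trans (cong (sum (f a) ℚ.+_) (∑ₗ-∑-comm f as)) (sym (∑-distrib-+ (f a) _))

point : {n : ℕ} → Fin n → Fin n → Bool
point a z = isYes (z ≟ a)

∑-point : ∀ {n} (h : Fin n → ℚ) a → ∑[ z < n ] restrict (point a) h z ≡ h a
∑-point {ℕ.suc n} h zero    =
  trans (cong (h zero ℚ.+_) (sum-replicate-zero n)) (ℚ.+-identityʳ (h zero))
∑-point {ℕ.suc n} h (suc a) = trans (ℚ.+-identityˡ _) (trans
  (sum-cong-≗ (λ z → cong (λ b → if b then h (suc z) else 0ℚ) (isYes-suc≟suc z a)))
  (∑-point (h ∘ suc) a))

module _ {n : ℕ} {h : Fin n → ℚ} (h≥0 : ∀ z → 0ℚ ℚ.≤ h z) where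

  restrict-nonneg : ∀ P z → 0ℚ ℚ.≤ restrict P h z
  restrict-nonneg P z with P z
  ... | true  = h≥0 z
  ... | false = ℚ.≤-refl

  private
    points : List (Fin n) → Fin n → ℚ
    points as z = ∑ₗ (λ a → restrict (point a) h z) as

    ∑-points : ∀ as → ∑[ z < n ] points as z ≡ ∑ₗ h as
    ∑-points as = trans (sym (∑ₗ-∑-comm (λ a → restrict (point a) h) as)) (∑ₗ-cong as (∑-point h))

    points-nonneg : ∀ as z → 0ℚ ℚ.≤ points as z
    points-nonneg as z = ∑ₗ-nonneg as (λ a → restrict-nonneg (point a) z)

    points-∉ : ∀ {z} as → All (z ≢_) as → points as z ≡ 0ℚ
    points-∉         []       []           = refl
    points-∉ {z = z} (a ∷ as) (z≢a ∷ z∉as) with z ≟ a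
    ... | yes z≡a = contradiction z≡a z≢a
    ... | no  _   = trans (ℚ.+-identityˡ _) (points-∉ as z∉as)

    points-≤-restrict : ∀ {P : Fin n → Bool} {as} → Unique as → All (T ∘ P) as →
                        ∀ z → points as z ℚ.≤ restrict P h z
    points-≤-restrict {P} {[]}     []            []         z = restrict-nonneg P z
    points-≤-restrict {P} {a ∷ as} (a∉as ∷ uniq) (Pa ∷ Pas) z with z ≟ a
    ... | yes refl = ℚ.≤-reflexive (begin
      h z + points as z ≡⟨ cong (h z ℚ.+_) (points-∉ as a∉as) ⟩
      h z + 0ℚ          ≡⟨ ℚ.+-identityʳ (h z) ⟩
      h z               ≡⟨ restrict-yes P h z Pa ⟨
      restrict P h z    ∎)
      where open ≡-Reasoning
    ... | no  _    = subst (ℚ._≤ restrict P h z) (sym (ℚ.+-identityˡ _)) (points-≤-restrict uniq Pas z)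

    restrict-≤-points : ∀ {P : Fin n → Bool} {as} → (∀ z → T (P z) → z ∈ as) →
                        ∀ z → restrict P h z ℚ.≤ points as z
    restrict-≤-points {P} {as} P⊆as z with P z in eq
    ... | true  = ∈⇒≤ (P⊆as z (subst T (sym eq) _))
      where
      ∈⇒≤ : ∀ {as} → z ∈ as → h z ℚ.≤ points as z
      ∈⇒≤ {a ∷ as} (here refl) with z ≟ z
      ... | yes _   = subst (ℚ._≤ h z + points as z) (ℚ.+-identityʳ (h z))
                        (ℚ.+-monoʳ-≤ (h z) (points-nonneg as z))
      ... | no  z≢z = contradiction refl z≢z
      ∈⇒≤ {a ∷ as} (there z∈as) = subst (ℚ._≤ points (a ∷ as) z) (ℚ.+-identityˡ (h z))
                                    (ℚ.+-mono-≤ (restrict-nonneg (point a) z) (∈⇒≤ z∈as))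
    ... | false = points-nonneg as z

  ∑ₗ-≤-weight : ∀ {P : Fin n → Bool} {as} → Unique as → All (T ∘ P) as → ∑ₗ h as ℚ.≤ weight h P
  ∑ₗ-≤-weight {P} {as} uniq Pas = begin
    ∑ₗ h as                    ≡⟨ ∑-points as ⟨
    ∑[ z < n ] points as z     ≤⟨ ∑-mono-≤ (points-≤-restrict uniq Pas) ⟩
    ∑[ z < n ] restrict P h z  ≡⟨ weight≡∑ h P ⟨
    weight h P                 ∎
    where open ℚ.≤-Reasoning

  weight-≤-∑ₗ : ∀ {P : Fin n → Bool} {as} → (∀ z → T (P z) → z ∈ as) → weight h P ℚ.≤ ∑ₗ h as
  weight-≤-∑ₗ {P} {as} P⊆as = begin
    weight h P                 ≡⟨ weight≡∑ h P ⟩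
    ∑[ z < n ] restrict P h z  ≤⟨ ∑-mono-≤ (restrict-≤-points P⊆as) ⟩
    ∑[ z < n ] points as z     ≡⟨ ∑-points as ⟩
    ∑ₗ h as                    ∎
    where open ℚ.≤-Reasoning

count-suc : ∀ {n} (P : Fin (ℕ.suc n) → Bool) →
            count P ≡ (if P zero then ℕ.suc (count (P ∘ suc)) else count (P ∘ suc))
count-suc {n} P = cong (c zero) (begin
  foldr c 0 (tabulate suc)          ≡⟨ cong (foldr c 0) (map-tabulate id suc) ⟨
  foldr c 0 (map suc (tabulate id)) ≡⟨ foldr-map c suc 0 (tabulate id) ⟩
  count (P ∘ suc)                   ∎)
  where
  open ≡-Reasoning
  c : Fin (ℕ.suc n) → ℕ → ℕ
  c z acc = if P z then ℕ.suc acc else acc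

count-cong : ∀ {n} {P Q : Fin n → Bool} → (∀ z → P z ≡ Q z) → count P ≡ count Q
count-cong {ℕ.zero}  P≗Q = refl
count-cong {ℕ.suc n} {P} {Q} P≗Q
  rewrite count-suc P | count-suc Q | P≗Q zero | count-cong {P = P ∘ suc} {Q ∘ suc} (P≗Q ∘ suc) = refl

count-remove : ∀ {n} (P : Fin n → Bool) {a} → T (P a) →
               count P ≡ ℕ.suc (count (λ z → P z ∧ not (isYes (z ≟ a))))
count-remove {ℕ.suc n} P {zero} Pa
  rewrite count-suc P | count-suc (λ z → P z ∧ not (isYes (z ≟ zero))) with P zero
... | true = cong ℕ.suc (count-cong (λ z → sym (∧-identityʳ (P (suc z)))))
count-remove {ℕ.suc n} P {suc a} Pa
  rewrite count-suc P | count-suc (λ z → P z ∧ not (isYes (z ≟ suc a))) | ∧-identityʳ (P zero)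
        | count-remove (P ∘ suc) Pa
        | count-cong {Q = λ z → P (suc z) ∧ not (isYes (z ≟ a))}
                     (λ z → cong (λ b → P (suc z) ∧ not b) (isYes-suc≟suc z a))
        with P zero
... | true  = refl
... | false = refl

count-none : ∀ {n} (P : Fin n → Bool) → (∀ a → ¬ T (P a)) → count P ≡ 0
count-none {ℕ.zero}  P ¬P = refl
count-none {ℕ.suc n} P ¬P rewrite count-suc P with P zero in eq
... | true  = contradiction (subst T (sym eq) _) (¬P zero)
... | false = count-none (P ∘ suc) (¬P ∘ suc)

count-witness : ∀ {n} (P : Fin n → Bool) → count P ≢ 0 → ∃[ a ] T (P a)
count-witness {ℕ.zero}  P count≢0 = contradiction refl count≢0
count-witness {ℕ.suc n} P count≢0 rewrite count-suc P with P zero in eq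
... | true  = zero , subst T (sym eq) _
... | false = let (a , Pa) = count-witness (P ∘ suc) count≢0 in suc a , Pa

count-positive : ∀ {n} (P : Fin n → Bool) {a} → T (P a) → count P ≢ 0
count-positive P Pa count≡0 = ℕ.1+n≢0 (trans (sym (count-remove P Pa)) count≡0)

count-unique : ∀ {n} (P : Fin n → Bool) → count P ≡ 1 → ∀ {a b} → T (P a) → T (P b) → b ≡ a
count-unique P count≡1 {a} {b} Pa Pb with b ≟ a
... | yes b≡a = b≡a
... | no  b≢a = contradiction (ℕ.suc-injective (trans (sym (count-remove P Pa)) count≡1))
  (count-positive (λ z → P z ∧ not (isYes (z ≟ a))) (Equivalence.from T-∧ (Pb , fromWitnessFalse b≢a)))

count-second : ∀ {n} (P : Fin n → Bool) → count P ≢ 1 → ∀ {a} → T (P a) → ∃[ b ] b ≢ a × T (P b)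
count-second P count≢1 {a} Pa =
  let (b , Pb∧b≢a) = count-witness (λ z → P z ∧ not (isYes (z ≟ a)))
                                   (count≢1 ∘ trans (count-remove P Pa) ∘ cong ℕ.suc)
      (Pb , b≢a)   = Equivalence.to T-∧ Pb∧b≢a
  in b , toWitnessFalse b≢a , Pb

∑-count : ∀ {n} (P : Fin n → Bool) d →
          ∑[ z < n ] restrict P (λ _ → + 1 / ℕ.suc d) z ≡ + count P / ℕ.suc d
∑-count {ℕ.zero}  P d = sym (ℚ.0/n≡0 (ℕ.suc d))
∑-count {ℕ.suc n} P d rewrite count-suc P with P zero
... | true  = trans (cong (+ 1 / ℕ.suc d ℚ.+_) (∑-count (P ∘ suc) d)) (sym (+-/ 1 (count (P ∘ suc)) d))
... | false = trans (ℚ.+-identityˡ _) (∑-count (P ∘ suc) d)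

∑-const : ∀ n d → ∑[ i < n ] (+ 1 / ℕ.suc d) ≡ + n / ℕ.suc d
∑-const n d = trans (∑-count {n} (λ _ → true) d) (cong (λ k → + k / ℕ.suc d) (count-all n))
  where
  count-all : ∀ n → count {n} (λ _ → true) ≡ n
  count-all ℕ.zero    = refl
  count-all (ℕ.suc n) = trans (count-suc {n} (λ _ → true)) (cong ℕ.suc (count-all n))

-- Graphs of diameter two

module _ {n : ℕ} (G : Graph n) where

  dist₂ : Fin n → Fin n → ℕ
  dist₂ x z = if isYes (x ≟ z) then 0 else if G x z then 1 else 2

  resolves₂ : Fin n → Fin n → Fin n → Bool
  resolves₂ x y z = not (dist₂ x z ℕ.≡ᵇ dist₂ y z)

  Diameter≤2 : Set
  Diameter≤2 = ∀ x z → x ≢ z → ¬ T (G x z) → ∃[ w ] T (G x w) × T (G w z)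

module _ {n : ℕ} (G : Graph n) where

  dist₂-self : ∀ x → dist₂ G x x ≡ 0
  dist₂-self x rewrite ≡-≟-identity _≟_ (refl {x = x}) = refl

  dist₂-adjacent : ∀ x z → x ≢ z → T (G x z) → dist₂ G x z ≡ 1
  dist₂-adjacent x z x≢z adj rewrite ≢-≟-identity _≟_ x≢z with G x z
  ... | true = refl

  dist₂-distant : ∀ x z → x ≢ z → ¬ T (G x z) → dist₂ G x z ≡ 2
  dist₂-distant x z x≢z ¬adj rewrite ≢-≟-identity _≟_ x≢z with G x z
  ... | true  = contradiction _ ¬adj
  ... | false = refl

  dist₂-positive : ∀ x z → x ≢ z → dist₂ G x z ≢ 0
  dist₂-positive x z x≢z rewrite ≢-≟-identity _≟_ x≢z with G x z
  ... | true  = λ ()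
  ... | false = λ ()

  dist₂≤2 : ∀ x z → dist₂ G x z ≤ 2
  dist₂≤2 x z with isYes (x ≟ z) | G x z
  ... | true  | _     = ℕ.z≤n
  ... | false | true  = ℕ.s≤s ℕ.z≤n
  ... | false | false = ℕ.s≤s (ℕ.s≤s ℕ.z≤n)

  resolves₂-intro : ∀ x y z → dist₂ G x z ≢ dist₂ G y z → T (resolves₂ G x y z)
  resolves₂-intro x y z d≢d with dist₂ G x z ℕ.≡ᵇ dist₂ G y z in eq
  ... | true  = contradiction (≡ᵇ⇒≡ _ _ (subst T (sym eq) _)) d≢d
  ... | false = _

  resolves₂-elim : ∀ x y z → T (resolves₂ G x y z) → dist₂ G x z ≢ dist₂ G y z
  resolves₂-elim x y z r d≡d with dist₂ G x z ℕ.≡ᵇ dist₂ G y z in eq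
  ... | true  = r
  ... | false = subst T eq (≡⇒≡ᵇ _ _ d≡d)

  resolves₂-left : ∀ x y → x ≢ y → T (resolves₂ G x y x)
  resolves₂-left x y x≢y =
    resolves₂-intro x y x λ d≡d → dist₂-positive y x (x≢y ∘ sym) (trans (sym d≡d) (dist₂-self x))

  resolves₂-right : ∀ x y → x ≢ y → T (resolves₂ G x y y)
  resolves₂-right x y x≢y =
    resolves₂-intro x y y λ d≡d → dist₂-positive x y x≢y (trans d≡d (dist₂-self y))

  resolves₂-comm : ∀ x y z → resolves₂ G x y z ≡ resolves₂ G y x z
  resolves₂-comm x y z = cong not (≡ᵇ-comm (dist₂ G x z) (dist₂ G y z))

  search-stop : ∀ f l x z → T (reach G l x z) → search G (ℕ.suc f) l x z ≡ l
  search-stop f l x z r rewrite Equivalence.to T-≡ r = refl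

  search-step : ∀ f l x z → ¬ T (reach G l x z) →
                search G (ℕ.suc f) l x z ≡ search G f (ℕ.suc l) x z
  search-step f l x z ¬r with reach G l x z
  ... | true  = contradiction _ ¬r
  ... | false = refl

  reach-1 : ∀ {x z} → x ≢ z → T (reach G 1 x z) ⇔ T (G x z)
  reach-1 {x} {z} x≢z rewrite ≢-≟-identity _≟_ x≢z = mk⇔
    (λ t → let (w , Gxw∧w≡z) = Equivalence.to (any-allFin step) t
               (Gxw , w≡z) = Equivalence.to T-∧ Gxw∧w≡z
           in subst (T ∘ G x) (toWitness w≡z) Gxw)
    (λ Gxz → Equivalence.from (any-allFin step) (z , Equivalence.from T-∧ (Gxz , fromWitness refl)))
    where
    step : Fin n → Bool
    step w = G x w ∧ isYes (w ≟ z)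

  reach-2 : ∀ {x w z} → T (G x w) → T (G w z) → T (reach G 2 x z)
  reach-2 {x} {w} {z} Gxw Gwz = Equivalence.from T-∨ (inj₂ (Equivalence.from (any-allFin _)
    (w , Equivalence.from T-∧ (Gxw , Equivalence.from T-∨ (inj₂ (Equivalence.from (any-allFin _)
      (z , Equivalence.from T-∧ (Gwz , fromWitness refl))))))))

dist≡dist₂ : ∀ {n} {G : Graph n} → Diameter≤2 G → ∀ x z → dist G x z ≡ dist₂ G x z
dist≡dist₂ {ℕ.suc ℕ.zero}                      _  zero zero = refl
dist≡dist₂ {ℕ.suc (ℕ.suc f)} {G = G} d2 x z = by-cases (x ≟ z) (T? (G x z))
  where
  open ≡-Reasoning
  by-cases : Dec (x ≡ z) → Dec (T (G x z)) → dist G x z ≡ dist₂ G x z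
  by-cases (yes refl) _ = trans (search-stop G (ℕ.suc f) 0 x x (fromWitness refl)) (sym (dist₂-self G x))
  by-cases (no x≢z) (yes adj) = begin
    search G (2 ℕ.+ f) 0 x z ≡⟨ search-step G (ℕ.suc f) 0 x z (x≢z ∘ toWitness) ⟩
    search G (1 ℕ.+ f) 1 x z ≡⟨ search-stop G f 1 x z (Equivalence.from (reach-1 G x≢z) adj) ⟩
    1                        ≡⟨ dist₂-adjacent G x z x≢z adj ⟨
    dist₂ G x z              ∎
  by-cases (no x≢z) (no ¬adj) = begin
    search G (2 ℕ.+ f) 0 x z ≡⟨ search-step G (ℕ.suc f) 0 x z (x≢z ∘ toWitness) ⟩
    search G (1 ℕ.+ f) 1 x z ≡⟨ search-step G f 1 x z (¬adj ∘ Equivalence.to (reach-1 G x≢z)) ⟩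
    search G f 2 x z         ≡⟨ search-end f ⟩
    2                        ≡⟨ dist₂-distant G x z x≢z ¬adj ⟨
    dist₂ G x z              ∎
    where
    search-end : ∀ f → search G f 2 x z ≡ 2
    search-end ℕ.zero    = refl
    search-end (ℕ.suc f′) =
      let (w , Gxw , Gwz) = d2 x z x≢z ¬adj in search-stop G f′ 2 x z (reach-2 G Gxw Gwz)

inR≡resolves₂ : ∀ {n} {G : Graph n} → Diameter≤2 G → ∀ {k} → 1 ≤ k →
                ∀ x y z → inR G k x y z ≡ resolves₂ G x y z
inR≡resolves₂ {G = G} d2 {ℕ.suc k} _ x y z =
  cong₂ (λ a b → not (a ℕ.≡ᵇ b)) (distk≡dist₂ x z) (distk≡dist₂ y z)
  where
  distk≡dist₂ : ∀ x z → distk G (ℕ.suc k) x z ≡ dist₂ G x z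
  distk≡dist₂ x z rewrite dist≡dist₂ d2 x z =
    ℕ.m≤n⇒m⊓n≡m (ℕ.≤-trans (dist₂≤2 G x z) (ℕ.s≤s (ℕ.s≤s ℕ.z≤n)))

IsResolving₂ : ∀ {n} → Graph n → (Fin n → ℚ) → Set
IsResolving₂ {n} G h =
  (∀ v → 0ℚ ℚ.≤ h v × h v ℚ.≤ 1ℚ) ×
  (∀ x y → x ≢ y → 1ℚ ℚ.≤ weight h (resolves₂ G x y))

module _ {n} {G : Graph n} (d2 : Diameter≤2 G) {k} (k≥1 : 1 ≤ k) where

  isResolvingFn⇔isResolving₂ : ∀ h → IsResolvingFn G k h ⇔ IsResolving₂ G h
  isResolvingFn⇔isResolving₂ h = mk⇔
    (λ (bounds , resolves) → bounds , λ x y x≢y →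
       subst (1ℚ ℚ.≤_) (weight-inR x y) (resolves x y x≢y))
    (λ (bounds , resolves) → bounds , λ x y x≢y →
       subst (1ℚ ℚ.≤_) (sym (weight-inR x y)) (resolves x y x≢y))
    where
    weight-inR : ∀ x y → weight h (inR G k x y) ≡ weight h (resolves₂ G x y)
    weight-inR x y = weight-cong h (inR≡resolves₂ d2 k≥1 x y)

  DimKF-diameter≤2 : ∀ {r} (h : Fin n → ℚ) → IsResolving₂ G h → ∑[ z < n ] h z ≡ r →
                     (∀ h → IsResolving₂ G h → r ℚ.≤ ∑[ z < n ] h z) → DimKF G k r
  DimKF-diameter≤2 {r} h res total≡r minimal =
    (h , Equivalence.from (isResolvingFn⇔isResolving₂ h) res , trans (weight≡∑ h _) total≡r) ,
    λ h′ res′ → subst (r ℚ.≤_) (sym (weight≡∑ h′ _))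
                  (minimal h′ (Equivalence.to (isResolvingFn⇔isResolving₂ h′) res′))

-- Lower bounds by duality

Certificate : ℕ → Set
Certificate n = List (ℚ × Fin n × Fin n)

value : ∀ {n} → Certificate n → ℚ
value = ∑ₗ proj₁

module _ {n : ℕ} (G : Graph n) where

  coverage : Certificate n → Fin n → ℚ
  coverage cs z = ∑ₗ (λ (y , a , b) → if resolves₂ G a b z then y else 0ℚ) cs

  IsFeasible : Certificate n → Set
  IsFeasible cs = All (λ (y , a , b) → a ≢ b × 0ℚ ℚ.≤ y) cs × (∀ z → coverage cs z ℚ.≤ 1ℚ)

  weak-duality : ∀ {cs h} → IsFeasible cs → IsResolving₂ G h → value cs ℚ.≤ ∑[ z < n ] h z
  weak-duality {cs} {h} (pairs , covered) (bounds , resolves) = begin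
    value cs
      ≤⟨ ∑ₗ-mono-≤ (All.map scale pairs) ⟩
    ∑ₗ (λ (y , a , b) → y * weight h (resolves₂ G a b)) cs
      ≡⟨ ∑ₗ-cong cs (λ (y , a , b) → scaled-weight y (resolves₂ G a b)) ⟩
    ∑ₗ (λ (y , a , b) → ∑[ z < n ] (y * restrict (resolves₂ G a b) h z)) cs
      ≡⟨ ∑ₗ-∑-comm (λ (y , a , b) z → y * restrict (resolves₂ G a b) h z) cs ⟩
    ∑[ z < n ] ∑ₗ (λ (y , a , b) → y * restrict (resolves₂ G a b) h z) cs
      ≡⟨ sum-cong-≗ collect ⟩
    ∑[ z < n ] (coverage cs z * h z)
      ≤⟨ ∑-mono-≤ covered-once ⟩
    ∑[ z < n ] h z ∎
    where
    open ℚ.≤-Reasoning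
    scaled-weight : ∀ y P → y * weight h P ≡ ∑[ z < n ] (y * restrict P h z)
    scaled-weight y P = trans (cong (y *_) (weight≡∑ h P)) (*-distribˡ-sum y (restrict P h))
    covered-once : ∀ z → coverage cs z * h z ℚ.≤ h z
    covered-once z = ℚ.≤-trans
      (ℚ.*-monoʳ-≤-nonNeg (h z) {{ℚ.nonNegative (proj₁ (bounds z))}} (covered z))
      (ℚ.≤-reflexive (ℚ.*-identityˡ (h z)))
    scale : ∀ {(y , a , b) : ℚ × Fin n × Fin n} → a ≢ b × 0ℚ ℚ.≤ y →
            y ℚ.≤ y * weight h (resolves₂ G a b)
    scale {y , a , b} (a≢b , y≥0) = ℚ.≤-trans (ℚ.≤-reflexive (sym (ℚ.*-identityʳ y)))
      (ℚ.*-monoˡ-≤-nonNeg y {{ℚ.nonNegative y≥0}} (resolves a b a≢b))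
    pull : ∀ y b t → y * (if b then t else 0ℚ) ≡ (if b then y else 0ℚ) * t
    pull y true  t = refl
    pull y false t = trans (ℚ.*-zeroʳ y) (sym (ℚ.*-zeroˡ t))
    collect : ∀ z → ∑ₗ (λ (y , a , b) → y * restrict (resolves₂ G a b) h z) cs ≡ coverage cs z * h z
    collect z =
      trans (∑ₗ-cong cs (λ (y , a , b) → pull y (resolves₂ G a b z) (h z))) (∑ₗ-*ʳ _ (h z) cs)

fractional-matching-bound :
  ∀ {n} (w : Fin n → Fin n → ℚ) (h : Fin n → ℚ) → (∀ x → 0ℚ ℚ.≤ h x) →
  (∀ x y → w x y ≡ w y x) → (∀ x → ∑[ y < n ] w x y ℚ.≤ + 1 / 2) →
  (∀ x y → w x y ℚ.≤ w x y * (h x + h y)) →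
  ∑[ x < n ] ∑[ y < n ] w x y ℚ.≤ ∑[ x < n ] h x
fractional-matching-bound {n} w h h≥0 w-comm row≤½ w≤w*[h+h] = begin
  ∑[ x < n ] ∑[ y < n ] w x y
    ≤⟨ ∑-mono-≤ (λ x → ∑-mono-≤ (w≤w*[h+h] x)) ⟩
  ∑[ x < n ] ∑[ y < n ] (w x y * (h x + h y))
    ≡⟨ sum-cong-≗ (λ x → trans (sum-cong-≗ (λ y → ℚ.*-distribˡ-+ (w x y) (h x) (h y)))
                                 (∑-distrib-+ (λ y → w x y * h x) (λ y → w x y * h y))) ⟩
  ∑[ x < n ] (∑[ y < n ] (w x y * h x) + ∑[ y < n ] (w x y * h y))
    ≡⟨ ∑-distrib-+ (λ x → ∑[ y < n ] (w x y * h x)) (λ x → ∑[ y < n ] (w x y * h y)) ⟩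
  ∑[ x < n ] ∑[ y < n ] (w x y * h x) + ∑[ x < n ] ∑[ y < n ] (w x y * h y)
    ≡⟨ cong (∑[ x < n ] ∑[ y < n ] (w x y * h x) ℚ.+_)
         (trans (∑-comm (λ x y → w x y * h y))
                (sum-cong-≗ (λ y → sum-cong-≗ (λ x → cong (_* h y) (w-comm x y))))) ⟩
  ∑[ x < n ] ∑[ y < n ] (w x y * h x) + ∑[ x < n ] ∑[ y < n ] (w x y * h x)
    ≡⟨ cong₂ _+_ row-sums row-sums ⟩
  ∑[ x < n ] (row x * h x) + ∑[ x < n ] (row x * h x)
    ≡⟨ ∑-distrib-+ (λ x → row x * h x) (λ x → row x * h x) ⟨
  ∑[ x < n ] (row x * h x + row x * h x)
    ≤⟨ ∑-mono-≤ twice-row-weight ⟩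
  ∑[ x < n ] h x ∎
  where
  open ℚ.≤-Reasoning
  row : Fin n → ℚ
  row x = ∑[ y < n ] w x y
  row-sums : ∑[ x < n ] ∑[ y < n ] (w x y * h x) ≡ ∑[ x < n ] (row x * h x)
  row-sums = sum-cong-≗ (λ x → sym (*-distribʳ-sum (h x) (w x)))
  twice-row-weight : ∀ x → row x * h x + row x * h x ℚ.≤ h x
  twice-row-weight x = begin
    row x * h x + row x * h x  ≡⟨ ℚ.*-distribʳ-+ (h x) (row x) (row x) ⟨
    (row x + row x) * h x      ≤⟨ ℚ.*-monoʳ-≤-nonNeg (h x) {{ℚ.nonNegative (h≥0 x)}}
                                    (ℚ.+-mono-≤ (row≤½ x) (row≤½ x)) ⟩
    1ℚ * h x                   ≡⟨ ℚ.*-identityˡ (h x) ⟩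
    h x                        ∎

-- Graphs checked by computation

module _ {n : ℕ} (G : Graph n) where

  diameter≤2? : Dec (Diameter≤2 G)
  diameter≤2? = Fin.all? λ x → Fin.all? λ z → ¬? (x ≟ z) →-dec ¬? (T? (G x z)) →-dec
                  Fin.any? λ w → T? (G x w) ×-dec T? (G w z)

  isResolving₂? : ∀ h → Dec (IsResolving₂ G h)
  isResolving₂? h = Fin.all? (λ v → 0ℚ ℚ.≤? h v ×-dec h v ℚ.≤? 1ℚ) ×-dec
                    Fin.all? λ x → Fin.all? λ y → ¬? (x ≟ y) →-dec
                      1ℚ ℚ.≤? weight h (resolves₂ G x y)

  isFeasible? : ∀ cs → Dec (IsFeasible G cs)
  isFeasible? cs = All.all? (λ (y , a , b) → ¬? (a ≟ b) ×-dec 0ℚ ℚ.≤? y) cs ×-dec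
                   Fin.all? λ z → coverage G cs z ℚ.≤? 1ℚ

DimKF-by-certificate : ∀ {n} {G : Graph n} {k r} → Diameter≤2 G → 1 ≤ k →
                       (h : Fin n → ℚ) (cs : Certificate n) →
                       True (isResolving₂? G h) → True (isFeasible? G cs) →
                       ∑[ z < n ] h z ≡ r → value cs ≡ r → DimKF G k r
DimKF-by-certificate {G = G} d2 k≥1 h cs res feasible total≡r value≡r =
  DimKF-diameter≤2 d2 k≥1 h (toWitness res) total≡r
    (λ h′ res′ → subst (ℚ._≤ _) value≡r (weak-duality G (toWitness feasible) res′))

petersen-diameter≤2 : Diameter≤2 petersen
petersen-diameter≤2 = toWitness {a? = diameter≤2? petersen} _

petersen-DimKF : ∀ {k} → 1 ≤ k → DimKF petersen k (+ 5 / 3)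
petersen-DimKF k≥1 = DimKF-by-certificate petersen-diameter≤2 k≥1 (λ _ → + 1 / 6)
  ((⅙ , # 4 , # 7) ∷ (⅙ , # 0 , # 7) ∷ (⅙ , # 7 , # 9) ∷ (⅙ , # 1 , # 7) ∷ (⅙ , # 6 , # 8) ∷
   (⅙ , # 5 , # 9) ∷ (⅙ , # 2 , # 5) ∷ (⅙ , # 7 , # 8) ∷ (⅙ , # 0 , # 8) ∷ (⅙ , # 2 , # 3) ∷ [])
  _ _ refl refl
  where ⅙ = + 1 / 6

wheel-diameter≤2 : ∀ n → Diameter≤2 (wheel n)
wheel-diameter≤2 n zero    zero    z≢z _    = contradiction refl z≢z
wheel-diameter≤2 n zero    (suc z) _   ¬adj = contradiction _ ¬adj
wheel-diameter≤2 n (suc x) zero    _   ¬adj = contradiction _ ¬adj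
wheel-diameter≤2 n (suc x) (suc z) _   _    = zero , _ , _

wheel₃-DimKF : ∀ {k} → 1 ≤ k → DimKF (wheel 3) k (+ 2 / 1)
wheel₃-DimKF k≥1 = DimKF-by-certificate (wheel-diameter≤2 3) k≥1 (λ _ → + 1 / 2)
  ((1ℚ , # 0 , # 1) ∷ (1ℚ , # 2 , # 3) ∷ []) _ _ refl refl

wheel₄-DimKF : ∀ {k} → 1 ≤ k → DimKF (wheel 4) k (+ 2 / 1)
wheel₄-DimKF k≥1 = DimKF-by-certificate (wheel-diameter≤2 4) k≥1 rim-halves
  ((1ℚ , # 1 , # 3) ∷ (1ℚ , # 2 , # 4) ∷ []) _ _ refl refl
  where
  rim-halves : Fin 5 → ℚ
  rim-halves zero    = 0ℚ
  rim-halves (suc _) = + 1 / 2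

wheel₅-DimKF : ∀ {k} → 1 ≤ k → DimKF (wheel 5) k (+ 3 / 2)
wheel₅-DimKF k≥1 = DimKF-by-certificate (wheel-diameter≤2 5) k≥1 (λ _ → + 1 / 4)
  ((⅒ , # 1 , # 2) ∷ (⅒ , # 2 , # 3) ∷ (⅒ , # 3 , # 4) ∷ (⅒ , # 4 , # 5) ∷ (⅒ , # 5 , # 1) ∷
   (⅕ , # 0 , # 1) ∷ (⅕ , # 0 , # 2) ∷ (⅕ , # 0 , # 3) ∷ (⅕ , # 0 , # 4) ∷ (⅕ , # 0 , # 5) ∷ [])
  _ _ refl refl
  where
  ⅒ = + 1 / 10
  ⅕ = + 1 / 5

-- Cycles

last-or-inject₁ : ∀ {m} (i : Fin (ℕ.suc m)) → i ≡ fromℕ m ⊎ ∃[ j ] i ≡ inject₁ j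
last-or-inject₁ {m} i with m ℕ.≟ toℕ i
... | yes m≡i = inj₁ (Fin.toℕ-injective (trans (sym m≡i) (sym (Fin.toℕ-fromℕ m))))
... | no  m≢i = inj₂ (lower₁ i m≢i , sym (Fin.inject₁-lower₁ i m≢i))

%-shift-≢ : ∀ t k N .{{_ : ℕ.NonZero N}} → 0 ℕ.< k → k ℕ.< N → (t ℕ.+ k) ℕ.% N ≢ t
%-shift-≢ t k N 0<k k<N eq = multiple {q} (ℕ.+-cancelˡ-≡ t k (q ℕ.* N) (begin
  t ℕ.+ k                      ≡⟨ m≡m%n+[m/n]*n (t ℕ.+ k) N ⟩
  (t ℕ.+ k) ℕ.% N ℕ.+ q ℕ.* N  ≡⟨ cong (ℕ._+ q ℕ.* N) eq ⟩
  t ℕ.+ q ℕ.* N                ∎))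
  where
  open ≡-Reasoning
  q = (t ℕ.+ k) ℕ./ N
  multiple : ∀ {q} → k ≡ q ℕ.* N → ⊥
  multiple {ℕ.zero}  k≡0  = ℕ.<⇒≢ 0<k (sym k≡0)
  multiple {ℕ.suc q} k≡N+ = ℕ.<⇒≱ k<N (subst (N ℕ.≤_) (sym k≡N+) (ℕ.m≤m+n N (q ℕ.* N)))

suc-%-% : ∀ a N .{{_ : ℕ.NonZero N}} → ℕ.suc (a ℕ.% N) ℕ.% N ≡ ℕ.suc a ℕ.% N
suc-%-% a N = begin
  (1 ℕ.+ a ℕ.% N) ℕ.% N                 ≡⟨ %-distribˡ-+ 1 (a ℕ.% N) N ⟩
  (1 ℕ.% N ℕ.+ a ℕ.% N ℕ.% N) ℕ.% N     ≡⟨ cong (λ r → (1 ℕ.% N ℕ.+ r) ℕ.% N) (m%n%n≡m%n a N) ⟩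
  (1 ℕ.% N ℕ.+ a ℕ.% N) ℕ.% N           ≡⟨ %-distribˡ-+ 1 a N ⟨
  (1 ℕ.+ a) ℕ.% N                       ∎
  where open ≡-Reasoning

module Cycle (m : ℕ) where

  N : ℕ
  N = ℕ.suc m

  next : Fin N → Fin N
  next i = ℕ.suc (toℕ i) mod N

  prev : Fin N → Fin N
  prev zero    = fromℕ m
  prev (suc i) = inject₁ i

  toℕ-next : ∀ i → toℕ (next i) ≡ ℕ.suc (toℕ i) ℕ.% N
  toℕ-next i = Fin.toℕ-fromℕ< _

  next-inject₁ : ∀ i → next (inject₁ i) ≡ suc i
  next-inject₁ i = Fin.toℕ-injective (begin
    toℕ (next (inject₁ i))         ≡⟨ toℕ-next (inject₁ i) ⟩
    ℕ.suc (toℕ (inject₁ i)) ℕ.% N  ≡⟨ cong (λ t → ℕ.suc t ℕ.% N) (Fin.toℕ-inject₁ i) ⟩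
    ℕ.suc (toℕ i) ℕ.% N            ≡⟨ m<n⇒m%n≡m (ℕ.s≤s (Fin.toℕ<n i)) ⟩
    ℕ.suc (toℕ i)                  ∎)
    where open ≡-Reasoning

  next-last : next (fromℕ m) ≡ zero
  next-last = Fin.toℕ-injective (trans (toℕ-next (fromℕ m))
    (trans (cong (λ t → ℕ.suc t ℕ.% N) (Fin.toℕ-fromℕ m)) (n%n≡0 N)))

  next-prev : ∀ j → next (prev j) ≡ j
  next-prev zero    = next-last
  next-prev (suc i) = next-inject₁ i

  prev-next : ∀ i → prev (next i) ≡ i
  prev-next i with last-or-inject₁ i
  ... | inj₁ refl       = cong prev next-last
  ... | inj₂ (j , refl) = cong prev (next-inject₁ j)

  next-injective : ∀ {i j} → next i ≡ next j → i ≡ j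
  next-injective {i} {j} eq = trans (sym (prev-next i)) (trans (cong prev eq) (prev-next j))

  next^ : ℕ → Fin N → Fin N
  next^ ℕ.zero    i = i
  next^ (ℕ.suc k) i = next (next^ k i)

  toℕ-next^ : ∀ k i → toℕ (next^ k i) ≡ (toℕ i ℕ.+ k) ℕ.% N
  toℕ-next^ ℕ.zero    i =
    trans (sym (m<n⇒m%n≡m (Fin.toℕ<n i))) (cong (ℕ._% N) (sym (ℕ.+-identityʳ (toℕ i))))
  toℕ-next^ (ℕ.suc k) i = begin
    toℕ (next (next^ k i))             ≡⟨ toℕ-next (next^ k i) ⟩
    ℕ.suc (toℕ (next^ k i)) ℕ.% N      ≡⟨ cong (λ t → ℕ.suc t ℕ.% N) (toℕ-next^ k i) ⟩
    ℕ.suc ((toℕ i ℕ.+ k) ℕ.% N) ℕ.% N  ≡⟨ suc-%-% (toℕ i ℕ.+ k) N ⟩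
    ℕ.suc (toℕ i ℕ.+ k) ℕ.% N          ≡⟨ cong (ℕ._% N) (ℕ.+-suc (toℕ i) k) ⟨
    (toℕ i ℕ.+ ℕ.suc k) ℕ.% N          ∎
    where open ≡-Reasoning

  next^-≢ : ∀ k i → 0 ℕ.< k → k ℕ.< N → next^ k i ≢ i
  next^-≢ k i 0<k k<N eq =
    %-shift-≢ (toℕ i) k N 0<k k<N (trans (sym (toℕ-next^ k i)) (cong toℕ eq))

  ∑-next : ∀ (f : Fin N → ℚ) → ∑[ i < N ] f (next i) ≡ ∑[ i < N ] f i
  ∑-next f = begin
    ∑[ i < N ] f (next i)
      ≡⟨ sum-init-last (f ∘ next) ⟩
    ∑[ i < m ] f (next (inject₁ i)) + f (next (fromℕ m))
      ≡⟨ cong₂ _+_ (sum-cong-≗ (cong f ∘ next-inject₁)) (cong f next-last) ⟩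
    ∑[ i < m ] f (suc i) + f zero
      ≡⟨ ℚ.+-comm _ (f zero) ⟩
    ∑[ i < N ] f i ∎
    where open ≡-Reasoning

  ∑-next^ : ∀ k (f : Fin N → ℚ) → ∑[ i < N ] f (next^ k i) ≡ ∑[ i < N ] f i
  ∑-next^ ℕ.zero    f = refl
  ∑-next^ (ℕ.suc k) f = trans (∑-next^ k (f ∘ next)) (∑-next f)

  Adjacent : Fin N → Fin N → Set
  Adjacent x y = y ≡ next x ⊎ x ≡ next y

  adjacent? : ∀ x y → Dec (Adjacent x y)
  adjacent? x y = (y ≟ next x) ⊎-dec (x ≟ next y)

  successorᵇ : Fin N → Fin N → Bool
  successorᵇ x y = (toℕ y ℕ.≡ᵇ ℕ.suc (toℕ x)) ∨ ((toℕ x ℕ.≡ᵇ m) ∧ (toℕ y ℕ.≡ᵇ 0))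

  successorᵇ⇔next : ∀ x y → T (successorᵇ x y) ⇔ y ≡ next x
  successorᵇ⇔next x y = mk⇔ to from
    where
    to : T (successorᵇ x y) → y ≡ next x
    to t with Equivalence.to (T-∨ {toℕ y ℕ.≡ᵇ ℕ.suc (toℕ x)}) t
    ... | inj₁ y≡1+x = Fin.toℕ-injective (begin
      toℕ y                ≡⟨ y≡1+x′ ⟩
      ℕ.suc (toℕ x)        ≡⟨ m<n⇒m%n≡m (subst (ℕ._< N) y≡1+x′ (Fin.toℕ<n y)) ⟨
      ℕ.suc (toℕ x) ℕ.% N  ≡⟨ toℕ-next x ⟨
      toℕ (next x)         ∎)
      where
      open ≡-Reasoning
      y≡1+x′ = Equivalence.to T-≡ᵇ y≡1+x
    ... | inj₂ x≡m∧y≡0 = Fin.toℕ-injective (begin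
      toℕ y                ≡⟨ Equivalence.to T-≡ᵇ y≡0 ⟩
      0                    ≡⟨ n%n≡0 N ⟨
      N ℕ.% N              ≡⟨ cong (λ t → ℕ.suc t ℕ.% N) (Equivalence.to T-≡ᵇ x≡m) ⟨
      ℕ.suc (toℕ x) ℕ.% N  ≡⟨ toℕ-next x ⟨
      toℕ (next x)         ∎)
      where
      open ≡-Reasoning
      x≡m = proj₁ (Equivalence.to T-∧ x≡m∧y≡0)
      y≡0 = proj₂ (Equivalence.to T-∧ x≡m∧y≡0)
    from : y ≡ next x → T (successorᵇ x y)
    from refl with last-or-inject₁ x
    ... | inj₁ refl rewrite next-last = Equivalence.from T-∨ (inj₂ (Equivalence.from T-∧
      (Equivalence.from T-≡ᵇ (Fin.toℕ-fromℕ m) , _)))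
    ... | inj₂ (j , refl) rewrite next-inject₁ j = Equivalence.from T-∨ (inj₁ (Equivalence.from T-≡ᵇ
      (cong ℕ.suc (sym (Fin.toℕ-inject₁ j)))))

  cycleAdj⇔Adjacent : ∀ x y → T (cycleAdj N x y) ⇔ Adjacent x y
  cycleAdj⇔Adjacent x y = mk⇔
    (Data.Sum.map (Equivalence.to (successorᵇ⇔next x y)) (Equivalence.to (successorᵇ⇔next y x))
      ∘ Equivalence.to T-∨)
    (Equivalence.from T-∨
      ∘ Data.Sum.map (Equivalence.from (successorᵇ⇔next x y)) (Equivalence.from (successorᵇ⇔next y x)))

-- Wheels with at least six rim vertices

module LargeWheel (m : ℕ) (m≥5 : 5 ≤ m) where

  open Cycle m

  W : Graph (ℕ.suc N)
  W = wheel N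

  next^-+ : ∀ j i x → next^ j (next^ i x) ≡ next^ (j ℕ.+ i) x
  next^-+ ℕ.zero    i x = refl
  next^-+ (ℕ.suc j) i x = cong next (next^-+ j i x)

  short-orbit-≢ : ∀ k x → 0 ℕ.< k → k ≤ 4 → next^ k x ≢ x
  short-orbit-≢ k x 0<k k≤4 = next^-≢ k x 0<k (ℕ.s≤s (ℕ.≤-trans k≤4 (ℕ.≤-trans (ℕ.n≤1+n 4) m≥5)))

  next-≢ : ∀ x → next x ≢ x
  next-≢ x = short-orbit-≢ 1 x (ℕ.s≤s ℕ.z≤n) (ℕ.s≤s ℕ.z≤n)

  adjacent⇒≢ : ∀ {x y} → Adjacent x y → x ≢ y
  adjacent⇒≢ (inj₁ refl) = next-≢ _ ∘ sym
  adjacent⇒≢ (inj₂ refl) = next-≢ _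

  hub-rim-dist : ∀ y → dist₂ W zero (suc y) ≡ 1
  hub-rim-dist y = dist₂-adjacent W zero (suc y) (λ ()) _

  rim-hub-dist : ∀ y → dist₂ W (suc y) zero ≡ 1
  rim-hub-dist y = dist₂-adjacent W (suc y) zero (λ ()) _

  rim-dist-adjacent : ∀ {x y} → Adjacent x y → dist₂ W (suc x) (suc y) ≡ 1
  rim-dist-adjacent {x} {y} adj = dist₂-adjacent W (suc x) (suc y)
    (adjacent⇒≢ adj ∘ Fin.suc-injective) (Equivalence.from (cycleAdj⇔Adjacent x y) adj)

  rim-dist-distant : ∀ {x y} → x ≢ y → ¬ Adjacent x y → dist₂ W (suc x) (suc y) ≡ 2
  rim-dist-distant {x} {y} x≢y ¬adj = dist₂-distant W (suc x) (suc y)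
    (x≢y ∘ Fin.suc-injective) (¬adj ∘ Equivalence.to (cycleAdj⇔Adjacent x y))

  Blocked : Fin N → Fin N → Set
  Blocked b x = x ≡ b ⊎ Adjacent b x

  blocked? : ∀ b x → Dec (Blocked b x)
  blocked? b x = (x ≟ b) ⊎-dec adjacent? b x

  Near : Fin N → Fin N → Set
  Near a b = ∃[ k ] 1 ≤ k × k ≤ 2 × b ≡ next^ k a

  near-asym : ∀ {a b} → Near a b → Near b a → ⊥
  near-asym {a} (i , 1≤i , i≤2 , refl) (j , 1≤j , j≤2 , a≡) =
    short-orbit-≢ (j ℕ.+ i) a (ℕ.≤-trans 1≤j (ℕ.m≤m+n j i)) (ℕ.+-mono-≤ j≤2 i≤2)
      (sym (trans a≡ (next^-+ j i a)))

  next-blocked⇒near : ∀ {a b} → a ≢ b → Blocked b (next a) → Near a b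
  next-blocked⇒near a≢b (inj₁ a+1≡b)          = 1 , ℕ.≤-refl , ℕ.s≤s ℕ.z≤n , sym a+1≡b
  next-blocked⇒near a≢b (inj₂ (inj₁ a+1≡b+1)) = contradiction (next-injective a+1≡b+1) a≢b
  next-blocked⇒near a≢b (inj₂ (inj₂ b≡a+2))   = 2 , ℕ.s≤s ℕ.z≤n , ℕ.≤-refl , b≡a+2

  prev-blocked⇒near : ∀ {a b} → a ≢ b → Blocked b (prev a) → Near b a
  prev-blocked⇒near {a} a≢b (inj₁ a-1≡b) =
    1 , ℕ.≤-refl , ℕ.s≤s ℕ.z≤n , trans (sym (next-prev a)) (cong next a-1≡b)
  prev-blocked⇒near {a} a≢b (inj₂ (inj₁ a-1≡b+1)) =
    2 , ℕ.s≤s ℕ.z≤n , ℕ.≤-refl , trans (sym (next-prev a)) (cong next a-1≡b+1)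
  prev-blocked⇒near {a} a≢b (inj₂ (inj₂ b≡a)) =
    contradiction (sym (trans b≡a (next-prev a))) a≢b

  -- If both neighbours of a were blocked by b, then b would lie one or two steps after a and a one
  -- or two steps after b, i.e. the rim would have at most four vertices.
  escape : ∀ {a b} → a ≢ b → ∃[ x ] Adjacent a x × ¬ Blocked b x
  escape {a} {b} a≢b with blocked? b (next a) | blocked? b (prev a)
  ... | no ¬blocked | _            = next a , inj₁ refl , ¬blocked
  ... | yes _       | no ¬blocked  = prev a , inj₂ (sym (next-prev a)) , ¬blocked
  ... | yes blocked | yes blocked′ =
    contradiction (prev-blocked⇒near a≢b blocked′) (near-asym (next-blocked⇒near a≢b blocked))

  escape-resolves : ∀ {a b x} → Adjacent a x → ¬ Blocked b x → T (resolves₂ W (suc a) (suc b) (suc x))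
  escape-resolves {a} {b} {x} a~x ¬blocked = resolves₂-intro W (suc a) (suc b) (suc x) λ eq →
    1≢2 (trans (sym (rim-dist-adjacent a~x))
               (trans eq (rim-dist-distant (¬blocked ∘ inj₁ ∘ sym) (¬blocked ∘ inj₂))))

  quarter : Fin (ℕ.suc N) → ℚ
  quarter zero    = 0ℚ
  quarter (suc _) = + 1 / 4

  quarter-bounds : ∀ v → 0ℚ ℚ.≤ quarter v × quarter v ℚ.≤ 1ℚ
  quarter-bounds zero    = ≤-decide _ , ≤-decide _
  quarter-bounds (suc _) = ≤-decide _ , ≤-decide _

  quarter-nonneg : ∀ v → 0ℚ ℚ.≤ quarter v
  quarter-nonneg = proj₁ ∘ quarter-bounds

  quarter-total : ∑[ v < ℕ.suc N ] quarter v ≡ + N / 4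
  quarter-total = trans (ℚ.+-identityˡ _) (∑-const N 3)

  hub-complement : ∀ j z → ¬ T (resolves₂ W zero (suc j) z) → z ∈ suc (next j) ∷ suc (prev j) ∷ []
  hub-complement j zero    ¬R = contradiction (resolves₂-left W zero (suc j) (λ ())) ¬R
  hub-complement j (suc y) ¬R with y ≟ j | adjacent? j y
  ... | yes refl | _                    = contradiction (resolves₂-right W zero (suc j) (λ ())) ¬R
  ... | no _     | yes (inj₁ y≡next-j) = here (cong suc y≡next-j)
  ... | no _     | yes (inj₂ j≡next-y) =
    there (here (cong suc (trans (sym (prev-next y)) (cong prev (sym j≡next-y)))))
  ... | no y≢j   | no ¬adj              = contradiction (resolves₂-intro W zero (suc j) (suc y) λ eq →
    1≢2 (trans (sym (hub-rim-dist y)) (trans eq (rim-dist-distant (y≢j ∘ sym) ¬adj)))) ¬R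

  hub-pair : ∀ j → 1ℚ ℚ.≤ weight quarter (resolves₂ W zero (suc j))
  hub-pair j = +-cancelʳ-≤ ½ 1ℚ (weight quarter R) (begin
    1ℚ + ½                                       ≤⟨ three-halves≤ ⟩
    + N / 4                                      ≡⟨ trans (sym quarter-total) (sym (weight-complement quarter R)) ⟩
    weight quarter R + weight quarter (not ∘ R)  ≤⟨ ℚ.+-monoʳ-≤ (weight quarter R) complement≤½ ⟩
    weight quarter R + ½                         ∎)
    where
    open ℚ.≤-Reasoning
    ½ = + 1 / 2
    R = resolves₂ W zero (suc j)
    complement≤½ : weight quarter (not ∘ R) ℚ.≤ ½
    complement≤½ = weight-≤-∑ₗ quarter-nonneg λ z → hub-complement j z ∘ T-not⇒¬T
    three-halves≤ : 1ℚ + ½ ℚ.≤ + N / 4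
    three-halves≤ = begin
      + 6 / 4                    ≡⟨ ℚ.+-identityʳ _ ⟨
      + 6 / 4 + 0ℚ               ≤⟨ ℚ.+-monoʳ-≤ (+ 6 / 4) r/4≥0 ⟩
      + 6 / 4 + + (m ∸ 5) / 4    ≡⟨ +-/ 6 (m ∸ 5) 3 ⟨
      + (6 ℕ.+ (m ∸ 5)) / 4      ≡⟨ cong (λ k → + ℕ.suc k / 4) (ℕ.m+[n∸m]≡n m≥5) ⟩
      + N / 4                    ∎
      where
      r/4≥0 : 0ℚ ℚ.≤ + (m ∸ 5) / 4
      r/4≥0 = ℚ.nonNegative⁻¹ (+ (m ∸ 5) / 4) {{ℚ.normalize-nonNeg (m ∸ 5) 4}}

  rim-pair : ∀ {a b} → a ≢ b → 1ℚ ℚ.≤ weight quarter (resolves₂ W (suc a) (suc b))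
  rim-pair {a} {b} a≢b =
    ∑ₗ-≤-weight quarter-nonneg {P = resolves₂ W (suc a) (suc b)} {as = suc a ∷ suc b ∷ suc x ∷ suc y ∷ []}
      ((lift a≢b ∷ lift a≢x ∷ lift a≢y ∷ []) ∷ (lift b≢x ∷ lift b≢y ∷ []) ∷ (lift x≢y ∷ []) ∷
       [] ∷ [])
      (resolves₂-left W _ _ (lift a≢b) ∷ resolves₂-right W _ _ (lift a≢b) ∷
       escape-resolves a~x ¬b-blocks-x ∷ swap (escape-resolves b~y ¬a-blocks-y) ∷ [])
    where
    x = proj₁ (escape a≢b)
    a~x = proj₁ (proj₂ (escape a≢b))
    ¬b-blocks-x = proj₂ (proj₂ (escape a≢b))
    y = proj₁ (escape (a≢b ∘ sym))
    b~y = proj₁ (proj₂ (escape (a≢b ∘ sym)))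
    ¬a-blocks-y = proj₂ (proj₂ (escape (a≢b ∘ sym)))
    lift : ∀ {u v : Fin N} → u ≢ v → suc u ≢ suc v
    lift u≢v = u≢v ∘ Fin.suc-injective
    a≢x = adjacent⇒≢ a~x
    b≢y = adjacent⇒≢ b~y
    a≢y = ¬a-blocks-y ∘ inj₁ ∘ sym
    b≢x = ¬b-blocks-x ∘ inj₁ ∘ sym
    x≢y : x ≢ y
    x≢y x≡y = ¬b-blocks-x (inj₂ (subst (Adjacent b) (sym x≡y) b~y))
    swap : T (resolves₂ W (suc b) (suc a) (suc y)) → T (resolves₂ W (suc a) (suc b) (suc y))
    swap = subst T (resolves₂-comm W (suc b) (suc a) (suc y))

  quarter-resolving : IsResolving₂ W quarter
  quarter-resolving = quarter-bounds , pair
    where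
    pair : ∀ x y → x ≢ y → 1ℚ ℚ.≤ weight quarter (resolves₂ W x y)
    pair zero    zero    x≢y = contradiction refl x≢y
    pair zero    (suc j) _   = hub-pair j
    pair (suc j) zero    _   =
      subst (1ℚ ℚ.≤_) (weight-cong quarter (resolves₂-comm W zero (suc j))) (hub-pair j)
    pair (suc a) (suc b) a≢b = rim-pair (a≢b ∘ cong suc)

  offsets : List ℕ
  offsets = 0 ∷ 1 ∷ 2 ∷ 3 ∷ []

  window : Fin N → List (Fin (ℕ.suc N))
  window j = map (λ k → suc (next^ k j)) offsets

  window-covers : ∀ j z → T (resolves₂ W (suc (next j)) (suc (next (next j))) z) → z ∈ window j
  window-covers j zero r =
    contradiction (trans (rim-hub-dist (next j)) (sym (rim-hub-dist (next (next j)))))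
      (resolves₂-elim W (suc (next j)) (suc (next (next j))) zero r)
  window-covers j (suc y) r = by-cases (y ≟ j) (y ≟ j+1) (y ≟ j+2) (y ≟ j+3)
    where
    j+1 = next j
    j+2 = next j+1
    j+3 = next j+2
    by-cases : Dec (y ≡ j) → Dec (y ≡ j+1) → Dec (y ≡ j+2) → Dec (y ≡ j+3) → suc y ∈ window j
    by-cases (yes y≡j) _ _ _   = here (cong suc y≡j)
    by-cases _ (yes y≡j+1) _ _ = there (here (cong suc y≡j+1))
    by-cases _ _ (yes y≡j+2) _ = there (there (here (cong suc y≡j+2)))
    by-cases _ _ _ (yes y≡j+3) = there (there (there (here (cong suc y≡j+3))))
    by-cases (no y≢j) (no y≢j+1) (no y≢j+2) (no y≢j+3) = contradiction
      (trans (rim-dist-distant (y≢j+1 ∘ sym) ¬adjacent₁) (sym (rim-dist-distant (y≢j+2 ∘ sym) ¬adjacent₂)))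
      (resolves₂-elim W (suc j+1) (suc j+2) (suc y) r)
      where
      ¬adjacent₁ : ¬ Adjacent j+1 y
      ¬adjacent₁ (inj₁ y≡j+2)   = y≢j+2 y≡j+2
      ¬adjacent₁ (inj₂ j+1≡y+1) = y≢j (sym (next-injective j+1≡y+1))
      ¬adjacent₂ : ¬ Adjacent j+2 y
      ¬adjacent₂ (inj₁ y≡j+3)   = y≢j+3 y≡j+3
      ¬adjacent₂ (inj₂ j+2≡y+1) = y≢j+1 (sym (next-injective j+2≡y+1))

  wheel-lower : ∀ h → IsResolving₂ W h → + N / 4 ℚ.≤ ∑[ v < ℕ.suc N ] h v
  wheel-lower h (bounds , resolves) = begin
    + N / 4
      ≡⟨ ∑-const N 3 ⟨
    ∑[ j < N ] ¼
      ≤⟨ ∑-mono-≤ window-bound ⟩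
    ∑[ j < N ] (¼ * ∑ₗ h (window j))
      ≡⟨ *-distribˡ-sum ¼ (λ j → ∑ₗ h (window j)) ⟨
    ¼ * ∑[ j < N ] ∑ₗ h (window j)
      ≡⟨ cong (¼ *_) (∑ₗ-∑-comm (λ k j → h (suc (next^ k j))) offsets) ⟨
    ¼ * ∑ₗ (λ k → ∑[ j < N ] h (suc (next^ k j))) offsets
      ≡⟨ cong (¼ *_) (∑ₗ-cong offsets (λ k → ∑-next^ k (h ∘ suc))) ⟩
    ¼ * ∑ₗ (λ _ → rim) offsets
      ≡⟨ solve 1 (λ s → con ¼ :* (s :+ (s :+ (s :+ (s :+ con 0ℚ)))) := s) refl rim ⟩
    rim
      ≡⟨ ℚ.+-identityˡ rim ⟨
    0ℚ + rim
      ≤⟨ ℚ.+-monoˡ-≤ rim (h≥0 zero) ⟩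
    h zero + rim ∎
    where
    open ℚ.≤-Reasoning
    open ℚ.+-*-Solver
    ¼ = + 1 / 4
    rim = ∑[ j < N ] h (suc j)
    h≥0 = proj₁ ∘ bounds
    window-bound : ∀ j → ¼ ℚ.≤ ¼ * ∑ₗ h (window j)
    window-bound j = ℚ.≤-trans (ℚ.≤-reflexive (sym (ℚ.*-identityʳ ¼)))
      (ℚ.*-monoˡ-≤-nonNeg ¼ (ℚ.≤-trans (resolves _ _ (next-≢ (next j) ∘ Fin.suc-injective ∘ sym))
                                       (weight-≤-∑ₗ h≥0 (window-covers j))))

  wheel-DimKF : ∀ {k} → 1 ≤ k → DimKF W k (+ N / 4)
  wheel-DimKF k≥1 =
    DimKF-diameter≤2 (wheel-diameter≤2 N) k≥1 quarter quarter-resolving quarter-total wheel-lower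

-- Complete multipartite graphs

another : ∀ {m} → 2 ≤ m → Fin m → Fin m
another (ℕ.s≤s (ℕ.s≤s ℕ.z≤n)) i = punchIn i zero

another-≢ : ∀ {m} (m≥2 : 2 ≤ m) i → another m≥2 i ≢ i
another-≢ (ℕ.s≤s (ℕ.s≤s ℕ.z≤n)) i = Fin.punchInᵢ≢i i zero

module CompleteMultipartite
  {n m : ℕ} (m≥2 : 2 ≤ m) (c : Fin n → Fin m) (c-surjective : Surjective _≡_ _≡_ c) where

  G : Graph n
  G = multipartite c

  representative : Fin m → Fin n
  representative i = proj₁ (c-surjective i)

  c-representative : ∀ i → c (representative i) ≡ i
  c-representative i = proj₂ (c-surjective i) refl

  adjacent⇔ : ∀ x y → T (G x y) ⇔ c x ≢ c y
  adjacent⇔ x y = mk⇔ toWitnessFalse fromWitnessFalse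

  same-part : ∀ {x y} → ¬ T (G x y) → c x ≡ c y
  same-part {x} {y} ¬adj with c x ≟ c y
  ... | yes cx≡cy = cx≡cy
  ... | no  cx≢cy = contradiction _ ¬adj

  diameter≤2 : Diameter≤2 G
  diameter≤2 x z _ ¬adj = w , Equivalence.from (adjacent⇔ x w) (cw≢cx ∘ sym) ,
                              Equivalence.from (adjacent⇔ w z) (cw≢cx ∘ flip trans (sym (same-part ¬adj)))
    where
    w = representative (another m≥2 (c x))
    cw≢cx : c w ≢ c x
    cw≢cx = subst (_≢ c x) (sym (c-representative _)) (another-≢ m≥2 (c x))

  dist₂-other-part : ∀ x z → c x ≢ c z → dist₂ G x z ≡ 1
  dist₂-other-part x z cx≢cz =
    dist₂-adjacent G x z (cx≢cz ∘ cong c) (Equivalence.from (adjacent⇔ x z) cx≢cz)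

  dist₂-same-part : ∀ x z → x ≢ z → c x ≡ c z → dist₂ G x z ≡ 2
  dist₂-same-part x z x≢z cx≡cz =
    dist₂-distant G x z x≢z (λ adj → Equivalence.to (adjacent⇔ x z) adj cx≡cz)

  in-part : Fin m → Fin n → Bool
  in-part i x = isYes (c x ≟ i)

  lone-part : Fin m → Bool
  lone-part i = partSize c i ℕ.≡ᵇ 1

  lone : Fin n → Bool
  lone x = lone-part (c x)

  lone-unique : ∀ {x z} → T (lone x) → c z ≡ c x → z ≡ x
  lone-unique {x} lone-x cz≡cx =
    count-unique (in-part (c x)) (Equivalence.to T-≡ᵇ lone-x) (fromWitness refl) (fromWitness cz≡cx)

  partner : ∀ {x} → ¬ T (lone x) → ∃[ x′ ] x′ ≢ x × c x′ ≡ c x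
  partner {x} ¬lone-x =
    let (x′ , x′≢x , same) =
          count-second (in-part (c x)) (¬lone-x ∘ Equivalence.from T-≡ᵇ) (fromWitness refl)
    in x′ , x′≢x , toWitness same

  Twin : Fin n → Fin n → Set
  Twin x y = c x ≡ c y ⊎ T (lone x) × T (lone y)

  twin? : ∀ x y → Dec (Twin x y)
  twin? x y = (c x ≟ c y) ⊎-dec (T? (lone x) ×-dec T? (lone y))

  twin-sym : ∀ {x y} → Twin x y → Twin y x
  twin-sym (inj₁ cx≡cy)              = inj₁ (sym cx≡cy)
  twin-sym (inj₂ (lone-x , lone-y)) = inj₂ (lone-y , lone-x)

  twin-trans : ∀ {x y z} → Twin x y → Twin y z → Twin x z
  twin-trans (inj₁ cx≡cy)     (inj₁ cy≡cz)             = inj₁ (trans cx≡cy cy≡cz)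
  twin-trans (inj₁ cx≡cy)     (inj₂ (lone-y , lone-z)) = inj₂ (subst (T ∘ lone-part) (sym cx≡cy) lone-y , lone-z)
  twin-trans (inj₂ (lone-x , lone-y)) (inj₁ cy≡cz)     = inj₂ (lone-x , subst (T ∘ lone-part) cy≡cz lone-y)
  twin-trans (inj₂ (lone-x , _)) (inj₂ (_ , lone-z))  = inj₂ (lone-x , lone-z)

  twins-agree : ∀ {x y} → Twin x y → ∀ z → z ≢ x → z ≢ y → dist₂ G x z ≡ dist₂ G y z
  twins-agree {x} {y} xy z z≢x z≢y = by-cases xy (c x ≟ c z)
    where
    by-cases : Twin x y → Dec (c x ≡ c z) → dist₂ G x z ≡ dist₂ G y z
    by-cases (inj₁ cx≡cy) (yes cx≡cz) = trans (dist₂-same-part x z (z≢x ∘ sym) cx≡cz)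
      (sym (dist₂-same-part y z (z≢y ∘ sym) (trans (sym cx≡cy) cx≡cz)))
    by-cases (inj₁ cx≡cy) (no cx≢cz) = trans (dist₂-other-part x z cx≢cz)
      (sym (dist₂-other-part y z (cx≢cz ∘ trans cx≡cy)))
    by-cases (inj₂ (lone-x , lone-y)) _ = trans (dist₂-other-part x z (z≢x ∘ lone-unique lone-x ∘ sym))
      (sym (dist₂-other-part y z (z≢y ∘ lone-unique lone-y ∘ sym)))

  twin-resolving-set : ∀ {x y} → Twin x y → ∀ z → T (resolves₂ G x y z) → z ∈ x ∷ y ∷ []
  twin-resolving-set {x} {y} xy z r with z ≟ x | z ≟ y
  ... | yes z≡x | _       = here z≡x
  ... | no  _   | yes z≡y = there (here z≡y)
  ... | no  z≢x | no  z≢y = contradiction (twins-agree xy z z≢x z≢y) (resolves₂-elim G x y z r)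

  mate : Fin n → Fin n → Bool
  mate x y = isYes (twin? x y) ∧ not (isYes (y ≟ x))

  mate⇔ : ∀ x y → T (mate x y) ⇔ (Twin x y × y ≢ x)
  mate⇔ x y = mk⇔
    (λ t → let (xy , y≢x) = Equivalence.to (T-∧ {isYes (twin? x y)}) t in
           toWitness xy , toWitnessFalse y≢x)
    (λ (xy , y≢x) → Equivalence.from (T-∧ {isYes (twin? x y)}) (fromWitness xy , fromWitnessFalse y≢x))

  mate-sym : ∀ {x y} → T (mate x y) → T (mate y x)
  mate-sym {x} {y} m = let (xy , y≢x) = Equivalence.to (mate⇔ x y) m in
    Equivalence.from (mate⇔ y x) (twin-sym xy , y≢x ∘ sym)

  mates : Fin n → ℕ
  mates x = count (mate x)

  mates-twin : ∀ {x y} → Twin x y → mates x ≡ mates y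
  mates-twin {x} {y} xy = ℕ.suc-injective (begin
    ℕ.suc (mates x)  ≡⟨ count-remove (twins x) (fromWitness (inj₁ refl)) ⟨
    count (twins x)  ≡⟨ count-cong same-twins ⟩
    count (twins y)  ≡⟨ count-remove (twins y) (fromWitness (inj₁ refl)) ⟩
    ℕ.suc (mates y)  ∎)
    where
    open ≡-Reasoning
    twins : Fin n → Fin n → Bool
    twins x z = isYes (twin? x z)
    same-twins : ∀ z → twins x z ≡ twins y z
    same-twins z = T-injective (fromWitness ∘ twin-trans (twin-sym xy) ∘ toWitness)
                               (fromWitness ∘ twin-trans xy ∘ toWitness)

  paired : ∀ {x y} → Twin x y → y ≢ x → mates x ≢ 0
  paired {x} {y} xy y≢x = count-positive (mate x) (Equivalence.from (mate⇔ x y) (xy , y≢x))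

  unpaired⇒lone : ∀ {x} → mates x ≡ 0 → T (lone x)
  unpaired⇒lone {x} unpaired = decidable-stable (T? (lone x)) λ ¬lone-x →
    let (x′ , x′≢x , cx′≡cx) = partner ¬lone-x in
    contradiction unpaired (paired (inj₁ (sym cx′≡cx)) x′≢x)

  half-if-paired : ℕ → ℚ
  half-if-paired ℕ.zero    = 0ℚ
  half-if-paired (ℕ.suc _) = + 1 / 2

  τ : Fin n → ℚ
  τ x = half-if-paired (mates x)

  τ-paired : ∀ {x} → mates x ≢ 0 → τ x ≡ + 1 / 2
  τ-paired {x} paired-x with mates x
  ... | ℕ.zero  = contradiction refl paired-x
  ... | ℕ.suc _ = refl

  τ-bounds : ∀ x → 0ℚ ℚ.≤ τ x × τ x ℚ.≤ + 1 / 2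
  τ-bounds x with mates x
  ... | ℕ.zero  = ≤-decide _ , ≤-decide _
  ... | ℕ.suc _ = ≤-decide _ , ≤-decide _

  share : ℕ → ℚ
  share ℕ.zero    = 0ℚ
  share (ℕ.suc j) = + 1 / (2 ℕ.* ℕ.suc j)

  share-nonneg : ∀ j → 0ℚ ℚ.≤ share j
  share-nonneg ℕ.zero    = ℚ.≤-refl
  share-nonneg (ℕ.suc j) = ℚ.nonNegative⁻¹ _ {{ℚ.normalize-nonNeg 1 (2 ℕ.* ℕ.suc j)}}

  -- Dual weights: a vertex with twins spreads ½ evenly over the pairs it forms with them.
  ω : Fin n → Fin n → ℚ
  ω x = restrict (mate x) (λ _ → share (mates x))

  row-ω : ∀ x → ∑[ y < n ] ω x y ≡ τ x
  row-ω x with mates x in mates≡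
  ... | ℕ.zero  = trans (sum-cong-≗ (λ y → restrict-zero (mate x) y)) (sum-replicate-zero n)
  ... | ℕ.suc j = begin
    ∑[ y < n ] restrict (mate x) (λ _ → + 1 / (2 ℕ.* ℕ.suc j)) y
      ≡⟨ ∑-count (mate x) _ ⟩
    + mates x / (2 ℕ.* ℕ.suc j)
      ≡⟨ cong (λ k → + k / (2 ℕ.* ℕ.suc j)) mates≡ ⟩
    + ℕ.suc j / (2 ℕ.* ℕ.suc j)
      ≡⟨ ℚ.fromℚᵘ-cong j+1/2[j+1]≃½ ⟩
    + 1 / 2 ∎
    where
    open ≡-Reasoning
    j+1/2[j+1]≃½ : mkℚᵘ (+ ℕ.suc j) (j ℕ.+ ℕ.suc (j ℕ.+ 0)) ℚᵘ.≃ mkℚᵘ (+ 1) 1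
    j+1/2[j+1]≃½ = *≡* (cong +_ (trans (ℕ.*-comm (ℕ.suc j) 2) (sym (ℕ.*-identityˡ _))))

  ω-comm : ∀ x y → ω x y ≡ ω y x
  ω-comm x y with T? (mate x y)
  ... | yes m = begin
    ω x y             ≡⟨ restrict-yes (mate x) _ y m ⟩
    share (mates x)   ≡⟨ cong share (mates-twin (proj₁ (Equivalence.to (mate⇔ x y) m))) ⟩
    share (mates y)   ≡⟨ restrict-yes (mate y) _ x (mate-sym m) ⟨
    ω y x             ∎
    where open ≡-Reasoning
  ... | no ¬m =
    trans (restrict-no (mate x) _ y ¬m) (sym (restrict-no (mate y) _ x (¬m ∘ mate-sym)))

  twin-pair-bound : ∀ h → IsResolving₂ G h → ∀ {x y} → Twin x y → x ≢ y → 1ℚ ℚ.≤ h x + h y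
  twin-pair-bound h (bounds , resolves) {x} {y} xy x≢y = begin
    1ℚ                            ≤⟨ resolves x y x≢y ⟩
    weight h (resolves₂ G x y)    ≤⟨ weight-≤-∑ₗ (proj₁ ∘ bounds) (twin-resolving-set xy) ⟩
    h x + (h y + 0ℚ)              ≡⟨ cong (h x ℚ.+_) (ℚ.+-identityʳ (h y)) ⟩
    h x + h y                     ∎
    where open ℚ.≤-Reasoning

  τ-minimal : ∀ h → IsResolving₂ G h → ∑[ x < n ] τ x ℚ.≤ ∑[ x < n ] h x
  τ-minimal h res@(bounds , _) = subst (ℚ._≤ ∑[ x < n ] h x) (sum-cong-≗ row-ω)
    (fractional-matching-bound ω h (proj₁ ∘ bounds) ω-comm
      (λ x → subst (ℚ._≤ + 1 / 2) (sym (row-ω x)) (proj₂ (τ-bounds x))) ω≤ω*[h+h])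
    where
    ω≤ω*[h+h] : ∀ x y → ω x y ℚ.≤ ω x y * (h x + h y)
    ω≤ω*[h+h] x y with T? (mate x y)
    ... | yes m = let (xy , y≢x) = Equivalence.to (mate⇔ x y) m in
      subst (λ w → w ℚ.≤ w * (h x + h y)) (sym (restrict-yes (mate x) _ y m))
        (ℚ.≤-trans (ℚ.≤-reflexive (sym (ℚ.*-identityʳ (share (mates x)))))
          (ℚ.*-monoˡ-≤-nonNeg (share (mates x)) {{ℚ.nonNegative (share-nonneg (mates x))}}
            (twin-pair-bound h res xy (y≢x ∘ sym))))
    ... | no ¬m = subst (λ w → w ℚ.≤ w * (h x + h y)) (sym (restrict-no (mate x) _ y ¬m))
                    (ℚ.≤-reflexive (sym (ℚ.*-zeroˡ (h x + h y))))

  τ-nonneg : ∀ x → 0ℚ ℚ.≤ τ x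
  τ-nonneg = proj₁ ∘ τ-bounds

  resolved-by-halves : ∀ x y {u v} → u ≢ v → mates u ≢ 0 → mates v ≢ 0 →
                       T (resolves₂ G x y u) → T (resolves₂ G x y v) →
                       1ℚ ℚ.≤ weight τ (resolves₂ G x y)
  resolved-by-halves x y {u} {v} u≢v paired-u paired-v Ru Rv =
    subst (ℚ._≤ _) (cong₂ (λ a b → a + (b + 0ℚ)) (τ-paired paired-u) (τ-paired paired-v))
      (∑ₗ-≤-weight τ-nonneg {as = u ∷ v ∷ []} ((u≢v ∷ []) ∷ [] ∷ []) (Ru ∷ Rv ∷ []))

  unpaired-pair : ∀ {x y} → mates x ≡ 0 → x ≢ y → 1ℚ ℚ.≤ weight τ (resolves₂ G x y)
  unpaired-pair {x} {y} unpaired x≢y =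
    resolved-by-halves x y (y′≢y ∘ sym)
      (paired (inj₁ (sym cy′≡cy)) y′≢y) (paired (inj₁ cy′≡cy) (y′≢y ∘ sym))
      (resolves₂-right G x y x≢y) resolves-y′
    where
    ¬twin : ¬ Twin x y
    ¬twin xy = paired xy (x≢y ∘ sym) unpaired
    cx≢cy : c x ≢ c y
    cx≢cy = ¬twin ∘ inj₁
    ¬lone-y : ¬ T (lone y)
    ¬lone-y lone-y = ¬twin (inj₂ (unpaired⇒lone unpaired , lone-y))
    y′ = proj₁ (partner ¬lone-y)
    y′≢y = proj₁ (proj₂ (partner ¬lone-y))
    cy′≡cy = proj₂ (proj₂ (partner ¬lone-y))
    resolves-y′ : T (resolves₂ G x y y′)
    resolves-y′ = resolves₂-intro G x y y′ λ eq →
      1≢2 (trans (sym (dist₂-other-part x y′ (cx≢cy ∘ flip trans cy′≡cy)))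
                 (trans eq (dist₂-same-part y y′ (y′≢y ∘ sym) (sym cy′≡cy))))

  τ-resolving : IsResolving₂ G τ
  τ-resolving = (λ v → τ-nonneg v , ℚ.≤-trans (proj₂ (τ-bounds v)) (≤-decide _)) , pair
    where
    pair : ∀ x y → x ≢ y → 1ℚ ℚ.≤ weight τ (resolves₂ G x y)
    pair x y x≢y with mates x ℕ.≟ 0 | mates y ℕ.≟ 0
    ... | yes unpaired-x | _ = unpaired-pair unpaired-x x≢y
    ... | no  _ | yes unpaired-y =
      subst (1ℚ ℚ.≤_) (weight-cong τ (resolves₂-comm G y x)) (unpaired-pair unpaired-y (x≢y ∘ sym))
    ... | no paired-x | no paired-y = resolved-by-halves x y x≢y paired-x paired-y
                                        (resolves₂-left G x y x≢y) (resolves₂-right G x y x≢y)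

  all-paired : singletonParts c ≢ 1 → ∀ x → mates x ≢ 0
  all-paired s≢1 x unpaired =
    let lone-x = unpaired⇒lone unpaired
        (i , i≢cx , lone-i) = count-second lone-part s≢1 lone-x
    in paired (inj₂ (lone-x , subst (T ∘ lone-part) (sym (c-representative i)) lone-i))
              (i≢cx ∘ trans (sym (c-representative i)) ∘ cong c) unpaired

  τ-total-paired : singletonParts c ≢ 1 → ∑[ x < n ] τ x ≡ + n / 2
  τ-total-paired s≢1 = trans (sum-cong-≗ (τ-paired ∘ all-paired s≢1)) (∑-const n 1)

  module OneSingleton (s≡1 : singletonParts c ≡ 1) where

    the-lone-part : ∃[ i ] T (lone-part i)
    the-lone-part = count-witness lone-part (λ s≡0 → ℕ.1+n≢0 (trans (sym s≡1) s≡0))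

    v : Fin n
    v = representative (proj₁ the-lone-part)

    lone-v : T (lone v)
    lone-v = subst (T ∘ lone-part) (sym (c-representative _)) (proj₂ the-lone-part)

    lone⇒v : ∀ {x} → T (lone x) → x ≡ v
    lone⇒v lone-x = lone-unique lone-v (count-unique lone-part s≡1 lone-v lone-x)

    v-unpaired : mates v ≡ 0
    v-unpaired = count-none (mate v) λ y m →
      let (vy , y≢v) = Equivalence.to (mate⇔ v y) m in y≢v (twin-of-v vy)
      where
      twin-of-v : ∀ {y} → Twin v y → y ≡ v
      twin-of-v (inj₁ cv≡cy)      = lone-unique lone-v (sym cv≡cy)
      twin-of-v (inj₂ (_ , lone-y)) = lone⇒v lone-y

    others-paired : ∀ {x} → x ≢ v → mates x ≢ 0
    others-paired x≢v unpaired = x≢v (lone⇒v (unpaired⇒lone unpaired))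

    τ-total : ∑[ x < n ] τ x ≡ + (n ∸ 1) / 2
    τ-total = +-cancelʳ-≡ ½ _ _ (begin
      ∑[ x < n ] τ x + ½                         ≡⟨ cong (∑[ x < n ] τ x ℚ.+_) (∑-point (λ _ → ½) v) ⟨
      ∑[ x < n ] τ x + ∑[ x < n ] ½-at-v x       ≡⟨ ∑-distrib-+ τ ½-at-v ⟨
      ∑[ x < n ] (τ x + ½-at-v x)                ≡⟨ sum-cong-≗ (λ x → pointwise x (x ≟ v)) ⟩
      ∑[ x < n ] ½                               ≡⟨ ∑-const n 1 ⟩
      + n / 2                                    ≡⟨ n/2 v ⟩
      + (n ∸ 1) / 2 + ½                          ∎)
      where
      open ≡-Reasoning
      ½ = + 1 / 2
      ½-at-v : Fin n → ℚ
      ½-at-v = restrict (point v) (λ _ → ½)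
      pointwise : ∀ x → Dec (x ≡ v) → τ x + ½-at-v x ≡ ½
      pointwise x (yes refl) = trans
        (cong₂ _+_ (cong half-if-paired v-unpaired) (restrict-yes (point v) _ x (fromWitness refl)))
        (ℚ.+-identityˡ ½)
      pointwise x (no x≢v) = trans
        (cong₂ _+_ (τ-paired (others-paired x≢v)) (restrict-no (point v) _ x (x≢v ∘ toWitness)))
        (ℚ.+-identityʳ ½)
      n/2 : ∀ {n} → Fin n → + n / 2 ≡ + (n ∸ 1) / 2 + ½
      n/2 {ℕ.suc n} _ = trans (cong (λ k → + k / 2) (ℕ.+-comm 1 n)) (+-/ n 1 1)

  τ-total-one : singletonParts c ≡ 1 → ∑[ x < n ] τ x ≡ + (n ∸ 1) / 2
  τ-total-one = OneSingleton.τ-total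

  DimKF-one-singleton : ∀ {k} → 1 ≤ k → singletonParts c ≡ 1 → DimKF G k (+ (n ∸ 1) / 2)
  DimKF-one-singleton k≥1 s≡1 =
    DimKF-diameter≤2 diameter≤2 k≥1 τ τ-resolving (τ-total-one s≡1)
      λ h res → subst (ℚ._≤ _) (τ-total-one s≡1) (τ-minimal h res)

  DimKF-not-one-singleton : ∀ {k} → 1 ≤ k → singletonParts c ≢ 1 → DimKF G k (+ n / 2)
  DimKF-not-one-singleton k≥1 s≢1 =
    DimKF-diameter≤2 diameter≤2 k≥1 τ τ-resolving (τ-total-paired s≢1)
      λ h res → subst (ℚ._≤ _) (τ-total-paired s≢1) (τ-minimal h res)

corollary3p2 : (k : ℕ) → 1 ≤ k →
    DimKF petersen k (+ 5 / 3) ×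
    ((n : ℕ) → 3 ≤ n →
      ((n ≡ 3 ⊎ n ≡ 4) → DimKF (wheel n) k (+ 2 / 1)) ×
      (n ≡ 5 → DimKF (wheel n) k (+ 3 / 2)) ×
      (6 ≤ n → DimKF (wheel n) k (+ n / 4))) ×
    ((m n : ℕ) → 2 ≤ m → (c : Fin n → Fin m) → Surjective _≡_ _≡_ c →
      (singletonParts c ≡ 1 → DimKF (multipartite c) k (+ (n ∸ 1) / 2)) ×
      (singletonParts c ≢ 1 → DimKF (multipartite c) k (+ n / 2)))
corollary3p2 k k≥1 =
  petersen-DimKF k≥1 ,
  (λ n _ → wheel₃₄ n , wheel₅ n , wheel≥6 n) ,
  λ m n m≥2 c c-surjective → let open CompleteMultipartite m≥2 c c-surjective in
    DimKF-one-singleton k≥1 , DimKF-not-one-singleton k≥1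
  where
  wheel₃₄ : ∀ n → (n ≡ 3 ⊎ n ≡ 4) → DimKF (wheel n) k (+ 2 / 1)
  wheel₃₄ .3 (inj₁ refl) = wheel₃-DimKF k≥1
  wheel₃₄ .4 (inj₂ refl) = wheel₄-DimKF k≥1
  wheel₅ : ∀ n → n ≡ 5 → DimKF (wheel n) k (+ 3 / 2)
  wheel₅ .5 refl = wheel₅-DimKF k≥1
  wheel≥6 : ∀ n → 6 ≤ n → DimKF (wheel n) k (+ n / 4)
  wheel≥6 (ℕ.suc m) (ℕ.s≤s m≥5) = LargeWheel.wheel-DimKF m m≥5 k≥1
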